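{- Let $I=(i_0,i_1,\dots,i_r)$ be a type-$B$ composition of $n\ge1$. Then the expansion of $\tilde R_I(A,tA)$ on the basis $(\Lambda^J)$ of ${\bf Sym}$ is as follows, the sums running over all compositions $J=(j_1,\dots,j_s)$ of $n$: if $i_0=0$, with $I'=(i_1,\dots,i_r)$, $$\tilde R_I(A,tA)=\sum_J(-1)^{n+\ell(I')+\ell(J)}(-t)^{\,j_1+\sum_{k\in A'(I',J)}j_k}\,\Lambda^J;$$ if $i_0\neq0$, regarding $I$ itself as an ordinary composition, $$\tilde R_I(A,tA)=\sum_J(-1)^{n+1+\ell(I)+\ell(J)}(-t)^{\sum_{k\in A'(I,J)}j_k}\,\Lambda^J,$$ where for an ordinary composition $K$ of $n$, $A'(K,J)=\{k\in\{1,\dots,\ell(J)\}: j_1+\cdots+j_{k-1}\in\mathrm{Des}(K)\}$.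
   Context: ${\bf Sym}$ is the free associative algebra (over $\mathbb Q$) on generators $S_1,S_2,\dots$, with $S_0=1$; for a composition $J=(j_1,\dots,j_s)$ (positive parts), $S^J=S_{j_1}\cdots S_{j_s}$, $\ell(J)=s$, and $\mathrm{Des}(J)=\{j_1,j_1+j_2,\dots,j_1+\cdots+j_{s-1}\}$. Put $\Lambda_k=\sum_{K}(-1)^{k-\ell(K)}S^K$, the sum over compositions $K$ of $k$ ($\Lambda_0=1$), and $\Lambda^J=\Lambda_{j_1}\cdots\Lambda_{j_s}$; these form a basis. Let $\theta_t:{\bf Sym}\to{\bf Sym}[t]$ be the algebra homomorphism with $\theta_t(S_m)=\sum_{k=0}^m t^k\Lambda_kS_{m-k}$. A type-$B$ composition of $n$ is a sequence $I=(i_0,i_1,\dots,i_r)$ with $i_0\ge0$, $i_1,\dots,i_r\ge1$, summing to $n$; its $B$-descent set is $\mathrm{BDes}(I)=\{i_0,\,i_0+i_1,\dots,i_0+\cdots+i_{r-1}\}$. Set $\tilde S^I(t)=S_{i_0}\,\theta_t(S_{i_1}\cdots S_{i_r})$ and define $\tilde R_I(A,tA)\in{\bf Sym}[t]$ by $\tilde S^I(t)=\sum_{J}\tilde R_J(A,tA)$, the sum over type-$B$ compositions $J$ of $n$ with $\mathrm{BDes}(J)\subseteq\mathrm{BDes}(I)$. -}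

module Defs where

open import Data.Bool using (Bool; true; false; if_then_else_; _∧_; _∨_)
open import Data.Nat as ℕ using (ℕ; zero; suc; _∸_; _≡ᵇ_)
open import Data.List using (List; []; _∷_; _++_; map; concatMap; upTo; foldr; length; filterᵇ)
open import Data.List.Relation.Unary.All using (All)
open import Data.Product using (_×_; _,_)
open import Data.Rational as ℚ using (ℚ; 0ℚ; 1ℚ)
open import Relation.Binary.PropositionalEquality using (_≡_)

incrFirst : List ℕ → List (List ℕ)
incrFirst []       = []
incrFirst (x ∷ xs) = (suc x ∷ xs) ∷ []

compositions : ℕ → List (List ℕ)
compositions zero          = [] ∷ []
compositions (suc zero)    = (1 ∷ []) ∷ []
compositions (suc (suc n)) =
  concatMap (λ c → (1 ∷ c) ∷ incrFirst c) (compositions (suc n))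

psums : ℕ → List ℕ → List ℕ
psums a []           = []
psums a (x ∷ [])     = []
psums a (x ∷ y ∷ xs) = (a ℕ.+ x) ∷ psums (a ℕ.+ x) (y ∷ xs)

Des : List ℕ → List ℕ
Des J = psums 0 J

-- type-B compositions (i0 , (i1,...,ir))
BComp : Set
BComp = ℕ × List ℕ

sumℕ : List ℕ → ℕ
sumℕ = foldr ℕ._+_ 0

IsBComp : ℕ → BComp → Set
IsBComp n (i0 , I') = All (λ x → 1 ℕ.≤ x) I' × (i0 ℕ.+ sumℕ I' ≡ n)

bcomps : ℕ → List BComp
bcomps n = concatMap (λ i0 → map (λ c → (i0 , c)) (compositions (n ∸ i0))) (upTo (suc n))

BDes : BComp → List ℕ
BDes (i0 , [])     = []
BDes (i0 , x ∷ xs) = i0 ∷ psums i0 (x ∷ xs)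

memᵇ : ℕ → List ℕ → Bool
memᵇ x xs = foldr (λ y b → (x ≡ᵇ y) ∨ b) false xs

_⊆ᵇ_ : List ℕ → List ℕ → Bool
A ⊆ᵇ B = foldr (λ x b → memᵇ x B ∧ b) true A

-- Sym[t] over ℚ: finite formal sums of  q · t^e · S^w  (w a word in the
-- generators S_1, S_2, ...; the empty word is 1).  Equality is equality
-- of all coefficients on the basis  t^e S^w.

Term : Set
Term = ℚ × ℕ × List ℕ

SymT : Set
SymT = List Term

eqListᵇ : List ℕ → List ℕ → Bool
eqListᵇ []       []       = true
eqListᵇ (x ∷ xs) (y ∷ ys) = (x ≡ᵇ y) ∧ eqListᵇ xs ys
eqListᵇ _        _        = false

coeff : ℕ → List ℕ → SymT → ℚ
coeff e w []                 = 0ℚ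
coeff e w ((q , k , v) ∷ xs) =
  (if (k ≡ᵇ e) ∧ eqListᵇ v w then q else 0ℚ) ℚ.+ coeff e w xs

infix 4 _≈_
_≈_ : SymT → SymT → Set
x ≈ y = ∀ e w → coeff e w x ≡ coeff e w y

oneS : SymT
oneS = (1ℚ , 0 , []) ∷ []

infixl 7 _*S_
_*S_ : SymT → SymT → SymT
x *S y = concatMap (λ { (p , a , u) → map (λ { (q , b , v) → (p ℚ.* q , a ℕ.+ b , u ++ v) }) y }) x

sumS : List SymT → SymT
sumS = foldr _++_ []

prodS : List SymT → SymT
prodS = foldr _*S_ oneS

scale : ℚ → SymT → SymT
scale c = map (λ { (q , a , u) → (c ℚ.* q , a , u) })

tpow : ℕ → SymT → SymT
tpow e = map (λ { (q , a , u) → (q , e ℕ.+ a , u) })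

sgn : ℕ → ℚ
sgn zero    = 1ℚ
sgn (suc n) = ℚ.- sgn n

S : ℕ → SymT
S zero    = oneS
S (suc m) = (1ℚ , 0 , suc m ∷ []) ∷ []

Λ : ℕ → SymT
Λ k = map (λ K → (sgn (k ∸ length K) , 0 , K)) (compositions k)

ΛJ : List ℕ → SymT
ΛJ J = prodS (map Λ J)

θS : ℕ → SymT
θS m = sumS (map (λ k → tpow k (Λ k *S S (m ∸ k))) (upTo (suc m)))

-- S̃^I(t) = S_{i0} θ_t(S_{i1} ⋯ S_{ir})
S̃ : BComp → SymT
S̃ (i0 , I') = S i0 *S prodS (map θS I')

-- Σ_{k ∈ A'(K,J)} j_k, where A'(K,J) = {k : j1+...+j(k-1) ∈ Des K}
expA : List ℕ → ℕ → List ℕ → ℕ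
expA K a []       = 0
expA K a (j ∷ js) = (if memᵇ a (Des K) then j else 0) ℕ.+ expA K (a ℕ.+ j) js

first : List ℕ → ℕ
first []      = 0
first (j ∷ _) = j

-- (-1)^s (-t)^e Λ^J  =  (-1)^(s+e) t^e Λ^J
term : ℕ → ℕ → List ℕ → SymT
term s e J = scale (sgn (s ℕ.+ e)) (tpow e (ΛJ J))

formula : ℕ → BComp → SymT
formula n (zero , I') = sumS (map (λ J →
  term (n ℕ.+ length I' ℕ.+ length J) (first J ℕ.+ expA I' 0 J) J) (compositions n))
formula n (suc i , I') = sumS (map (λ J →
  term (n ℕ.+ 1 ℕ.+ length (suc i ∷ I') ℕ.+ length J) (expA (suc i ∷ I') 0 J) J) (compositions n))

-- S_n = Σ_{K ⊨ n} (-1)^(n - ℓ(K)) Λ^K, by strong induction on n from the first-part recursions of Λ_n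
-- and of the right-hand side; consequently θ_t(S_m) = Σ_{L ⊨ m} (-1)^(m - ℓ(L)) (1 - (-t)^(l₁)) Λ^L.
-- For a type-B composition J of n let F_J = Σ_{K ⊨ n} (-1)^(n + ℓ(J) + ℓ(K) + E) t^E Λ^K, where E sums the
-- parts of K that start at a B-descent of J.  Then F_J · θ_t(S_m) is F of J with a new last part m plus F of
-- J with its last part enlarged by m: expanding the product, the term for K and L lives on K ++ L, a composition
-- passing through n, and on compositions not passing through n the two right-hand sums cancel.  By induction on
-- the number of parts, S̃^I is the sum of F_J over the J with BDes J ⊆ BDes I, exactly like the sum of the
-- R̃_J.  That system is unitriangular (I is the only such J with as many parts as I), so R̃_I = F_I, which is the
-- formula of the statement in both cases.

module Submission where

open import Algebra.Bundles using (CommutativeMonoid)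
import Algebra.Properties.CommutativeSemigroup as CommSemigroupProperties
import Algebra.Properties.Group as GroupProperties
open import Data.Bool using (Bool; true; false; if_then_else_; _∧_; _∨_; T)
import Data.Bool.Properties as BP
open import Data.Empty using (⊥-elim)
open import Data.List using (List; []; _∷_; _++_; map; concatMap; upTo; length; filterᵇ; drop; applyUpTo; reverse; initLast; _∷ʳ′_)
import Data.List.Properties as LP
open import Data.List.Membership.Propositional using (_∈_; find; lose)
open import Data.List.Membership.Propositional.Properties
  using (∈-concatMap⁺; ∈-concatMap⁻; ∈-++⁻; ∈-map⁻; ∈-map⁺; ∈-++⁺ˡ; ∈-++⁺ʳ; ∈-upTo⁺; ∈-upTo⁻; ∈-filter⁻; ∈-filter⁺)
open import Data.List.Membership.Propositional.Properties.WithK using (unique∧set⇒bag)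
open import Data.List.Relation.Binary.BagAndSetEquality using (∼bag⇒↭)
open import Data.List.Relation.Binary.Disjoint.Propositional using (Disjoint)
open import Data.List.Relation.Binary.Permutation.Propositional using (_↭_)
import Data.List.Relation.Binary.Permutation.Propositional as ↭
open import Data.List.Relation.Unary.All using (All; []; _∷_)
import Data.List.Relation.Unary.All as Allm
import Data.List.Relation.Unary.All.Properties as AllP
open import Data.List.Relation.Unary.AllPairs using (AllPairs; []; _∷_)
import Data.List.Relation.Unary.AllPairs as AP
import Data.List.Relation.Unary.AllPairs.Properties as APP
open import Data.List.Relation.Unary.Any using (here; there)
open import Data.List.Relation.Unary.Unique.Propositional using (Unique)
import Data.List.Relation.Unary.Unique.Propositional.Properties as UP
open import Data.Nat as ℕ using (ℕ; zero; suc; _∸_; _≡ᵇ_; _≤_; _<_; z≤n; s≤s)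
import Data.Nat.ListAction.Properties as ListActionP
import Data.Nat.Properties as ℕP
open import Data.Nat.Tactic.RingSolver using (solve-∀)
open import Data.Product using (_×_; _,_; proj₁; proj₂; Σ)
import Data.Product.Properties
open import Data.Rational as ℚ using (ℚ; 0ℚ; 1ℚ)
import Data.Rational.Properties as ℚP
open import Data.Sum using (inj₁; inj₂)
open import Function using (_∘_; id)
open import Function.Bundles using (mk⇔)
open import Relation.Binary.Bundles using (Setoid)
open import Relation.Binary.Definitions using (tri<; tri≈; tri>)
open import Relation.Binary.PropositionalEquality
import Relation.Binary.Reasoning.Setoid as SetoidR
open import Relation.Nullary.Decidable.Core using (T?)

open import Defs

-- Coefficient extraction and the convolution formula for products

sumℚ : ∀ {A : Set} → List A → (A → ℚ) → ℚ
sumℚ []       f = 0ℚ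
sumℚ (x ∷ xs) f = f x ℚ.+ sumℚ xs f

sumℚ-cong : ∀ {A : Set} (xs : List A) {f g : A → ℚ} → (∀ x → f x ≡ g x) → sumℚ xs f ≡ sumℚ xs g
sumℚ-cong []       f≗g = refl
sumℚ-cong (x ∷ xs) f≗g = cong₂ ℚ._+_ (f≗g x) (sumℚ-cong xs f≗g)

sumℚ-zero : ∀ {A : Set} (xs : List A) → sumℚ xs (λ _ → 0ℚ) ≡ 0ℚ
sumℚ-zero []       = refl
sumℚ-zero (x ∷ xs) = trans (ℚP.+-identityˡ _) (sumℚ-zero xs)

+-interchange : ∀ a b c d → (a ℚ.+ b) ℚ.+ (c ℚ.+ d) ≡ (a ℚ.+ c) ℚ.+ (b ℚ.+ d)
+-interchange = CommSemigroupProperties.interchange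
  (CommutativeMonoid.commutativeSemigroup ℚP.+-0-commutativeMonoid)

sumℚ-+ : ∀ {A : Set} (xs : List A) (f g : A → ℚ) → sumℚ xs (λ x → f x ℚ.+ g x) ≡ sumℚ xs f ℚ.+ sumℚ xs g
sumℚ-+ []       f g = sym (ℚP.+-identityˡ 0ℚ)
sumℚ-+ (x ∷ xs) f g = trans (cong (f x ℚ.+ g x ℚ.+_) (sumℚ-+ xs f g)) (+-interchange (f x) (g x) (sumℚ xs f) (sumℚ xs g))

sumℚ-*ˡ : ∀ {A : Set} (xs : List A) (c : ℚ) (f : A → ℚ) → sumℚ xs (λ x → c ℚ.* f x) ≡ c ℚ.* sumℚ xs f
sumℚ-*ˡ []       c f = sym (ℚP.*-zeroʳ c)
sumℚ-*ˡ (x ∷ xs) c f = trans (cong (c ℚ.* f x ℚ.+_) (sumℚ-*ˡ xs c f)) (sym (ℚP.*-distribˡ-+ c (f x) _))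

sumℚ-++ : ∀ {A : Set} (xs ys : List A) (f : A → ℚ) → sumℚ (xs ++ ys) f ≡ sumℚ xs f ℚ.+ sumℚ ys f
sumℚ-++ []       ys f = sym (ℚP.+-identityˡ _)
sumℚ-++ (x ∷ xs) ys f = trans (cong (f x ℚ.+_) (sumℚ-++ xs ys f)) (sym (ℚP.+-assoc (f x) (sumℚ xs f) (sumℚ ys f)))

sumℚ-map : ∀ {A B : Set} (xs : List A) (g : A → B) (f : B → ℚ) → sumℚ (map g xs) f ≡ sumℚ xs (f ∘ g)
sumℚ-map []       g f = refl
sumℚ-map (x ∷ xs) g f = cong (f (g x) ℚ.+_) (sumℚ-map xs g f)

when : Bool → ℚ → ℚ
when b q = if b then q else 0ℚ

when-∧ : ∀ a b q → when (a ∧ b) q ≡ when a (when b q)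
when-∧ true  b q = refl
when-∧ false b q = refl

when-*ʳ : ∀ b x y → when b x ℚ.* y ≡ when b (x ℚ.* y)
when-*ʳ true  x y = refl
when-*ʳ false x y = ℚP.*-zeroˡ y

*-whenˡ : ∀ b x y → x ℚ.* when b y ≡ when b (x ℚ.* y)
*-whenˡ true  x y = refl
*-whenˡ false x y = ℚP.*-zeroʳ x

sumℚ-when : ∀ {A : Set} b (xs : List A) (f : A → ℚ) → sumℚ xs (λ x → when b (f x)) ≡ when b (sumℚ xs f)
sumℚ-when true  xs f = refl
sumℚ-when false xs f = sumℚ-zero xs

coeffTerm : ℕ → List ℕ → Term → ℚ
coeffTerm e w (q , k , v) = when ((k ≡ᵇ e) ∧ eqListᵇ v w) q

coeff≡sumℚ : ∀ e w x → coeff e w x ≡ sumℚ x (coeffTerm e w)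
coeff≡sumℚ e w []      = refl
coeff≡sumℚ e w (t ∷ x) = cong (coeffTerm e w t ℚ.+_) (coeff≡sumℚ e w x)

coeff-++ : ∀ e w x y → coeff e w (x ++ y) ≡ coeff e w x ℚ.+ coeff e w y
coeff-++ e w x y = trans (coeff≡sumℚ e w (x ++ y)) (trans (sumℚ-++ x y _)
  (sym (cong₂ ℚ._+_ (coeff≡sumℚ e w x) (coeff≡sumℚ e w y))))

mulTerm : Term → Term → Term
mulTerm (p , a , u) (q , b , v) = (p ℚ.* q , a ℕ.+ b , u ++ v)

-- Unlike Data.Nat's _≤ᵇ_, this reduces on suc/suc for open terms.
leᵇ : ℕ → ℕ → Bool
leᵇ zero    e       = true
leᵇ (suc a) zero    = false
leᵇ (suc a) (suc e) = leᵇ a e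

isPrefixᵇ : List ℕ → List ℕ → Bool
isPrefixᵇ []      w       = true
isPrefixᵇ (y ∷ u) []      = false
isPrefixᵇ (y ∷ u) (x ∷ w) = (y ≡ᵇ x) ∧ isPrefixᵇ u w

+-≡ᵇ : ∀ a b e → ((a ℕ.+ b) ≡ᵇ e) ≡ (leᵇ a e ∧ (b ≡ᵇ (e ∸ a)))
+-≡ᵇ zero    b e       = refl
+-≡ᵇ (suc a) b zero    = refl
+-≡ᵇ (suc a) b (suc e) = +-≡ᵇ a b e

eqListᵇ-++ : ∀ u v w → eqListᵇ (u ++ v) w ≡ (isPrefixᵇ u w ∧ eqListᵇ v (drop (length u) w))
eqListᵇ-++ []      v w       = refl
eqListᵇ-++ (y ∷ u) v []      = refl
eqListᵇ-++ (y ∷ u) v (x ∷ w) with y ≡ᵇ x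
... | true  = eqListᵇ-++ u v w
... | false = refl

-- The coefficient of t^e S^w in  t·y  is read off the "quotient" of (e , w) by the exponent and word of t.
quotCoeff : ℕ → List ℕ → ℕ → List ℕ → SymT → ℚ
quotCoeff a u e w y = when (leᵇ a e) (when (isPrefixᵇ u w) (coeff (e ∸ a) (drop (length u) w) y))

coeffTerm-mulTerm : ∀ e w p a u s → coeffTerm e w (mulTerm (p , a , u) s)
  ≡ when (leᵇ a e) (when (isPrefixᵇ u w) (p ℚ.* coeffTerm (e ∸ a) (drop (length u) w) s))
coeffTerm-mulTerm e w p a u (q , b , v)
  rewrite +-≡ᵇ a b e | eqListᵇ-++ u v w = reassoc (leᵇ a e) (b ≡ᵇ (e ∸ a)) (isPrefixᵇ u w) _
  where
  reassoc : ∀ A B C D → when ((A ∧ B) ∧ (C ∧ D)) (p ℚ.* q) ≡ when A (when C (p ℚ.* when (B ∧ D) q))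
  reassoc true  true  true  true  = refl
  reassoc true  true  true  false = sym (ℚP.*-zeroʳ p)
  reassoc true  false true  D     = sym (ℚP.*-zeroʳ p)
  reassoc true  true  false D     = refl
  reassoc true  false false D     = refl
  reassoc false B     C     D     = refl

coeff-map-mulTerm : ∀ e w p a u y → coeff e w (map (mulTerm (p , a , u)) y) ≡ p ℚ.* quotCoeff a u e w y
coeff-map-mulTerm e w p a u y = begin
  coeff e w (map (mulTerm (p , a , u)) y)         ≡⟨ coeff≡sumℚ e w (map (mulTerm (p , a , u)) y) ⟩
  sumℚ (map (mulTerm (p , a , u)) y) (coeffTerm e w) ≡⟨ sumℚ-map y _ _ ⟩
  sumℚ y (λ s → coeffTerm e w (mulTerm (p , a , u) s)) ≡⟨ sumℚ-cong y (coeffTerm-mulTerm e w p a u) ⟩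
  sumℚ y (λ s → when A (when B (p ℚ.* coeffTerm e' w' s)))
    ≡⟨ trans (sumℚ-when A y _) (cong (when A) (sumℚ-when B y _)) ⟩
  when A (when B (sumℚ y (λ s → p ℚ.* coeffTerm e' w' s)))
    ≡⟨ cong (λ z → when A (when B z)) (trans (sumℚ-*ˡ y p _) (cong (p ℚ.*_) (sym (coeff≡sumℚ e' w' y)))) ⟩
  when A (when B (p ℚ.* coeff e' w' y))
    ≡⟨ sym (trans (*-whenˡ A p _) (cong (when A) (*-whenˡ B p _))) ⟩
  p ℚ.* quotCoeff a u e w y ∎
  where
  open ≡-Reasoning
  A = leᵇ a e
  B = isPrefixᵇ u w
  e' = e ∸ a
  w' = drop (length u) w

splitsℕ : ℕ → List (ℕ × ℕ)
splitsℕ zero    = (0 , 0) ∷ []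
splitsℕ (suc e) = (0 , suc e) ∷ map (λ p → (suc (proj₁ p) , proj₂ p)) (splitsℕ e)

splitsList : List ℕ → List (List ℕ × List ℕ)
splitsList []      = ([] , []) ∷ []
splitsList (x ∷ w) = ([] , x ∷ w) ∷ map (λ p → (x ∷ proj₁ p , proj₂ p)) (splitsList w)

sumℚ-splitsℕ-select : ∀ e a (g : ℕ → ℚ) →
  sumℚ (splitsℕ e) (λ p → when (a ≡ᵇ proj₁ p) (g (proj₂ p))) ≡ when (leᵇ a e) (g (e ∸ a))
sumℚ-splitsℕ-select zero    zero    g = ℚP.+-identityʳ _
sumℚ-splitsℕ-select zero    (suc a) g = ℚP.+-identityʳ _
sumℚ-splitsℕ-select (suc e) zero    g =
  trans (cong (g (suc e) ℚ.+_) (trans (sumℚ-map (splitsℕ e) _ _) (sumℚ-zero (splitsℕ e)))) (ℚP.+-identityʳ _)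
sumℚ-splitsℕ-select (suc e) (suc a) g =
  trans (ℚP.+-identityˡ _) (trans (sumℚ-map (splitsℕ e) _ _) (sumℚ-splitsℕ-select e a g))

sumℚ-splitsList-select : ∀ w u (g : List ℕ → ℚ) →
  sumℚ (splitsList w) (λ p → when (eqListᵇ u (proj₁ p)) (g (proj₂ p))) ≡ when (isPrefixᵇ u w) (g (drop (length u) w))
sumℚ-splitsList-select []      []      g = ℚP.+-identityʳ _
sumℚ-splitsList-select []      (y ∷ u) g = ℚP.+-identityʳ _
sumℚ-splitsList-select (x ∷ w) []      g =
  trans (cong (g (x ∷ w) ℚ.+_) (trans (sumℚ-map (splitsList w) _ _) (sumℚ-zero (splitsList w)))) (ℚP.+-identityʳ _)
sumℚ-splitsList-select (x ∷ w) (y ∷ u) g = trans (ℚP.+-identityˡ _) (trans (sumℚ-map (splitsList w) _ _) (step (y ≡ᵇ x)))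
  where
  step : ∀ b → sumℚ (splitsList w) (λ p → when (b ∧ eqListᵇ u (proj₁ p)) (g (proj₂ p)))
             ≡ when (b ∧ isPrefixᵇ u w) (g (drop (length u) w))
  step true  = sumℚ-splitsList-select w u g
  step false = sumℚ-zero (splitsList w)

convolution : (ℕ → List ℕ → ℚ) → ℕ → List ℕ → SymT → ℚ
convolution c e w y =
  sumℚ (splitsℕ e) (λ n → sumℚ (splitsList w) (λ m → c (proj₁ n) (proj₁ m) ℚ.* coeff (proj₂ n) (proj₂ m) y))

quotCoeff≡convolution : ∀ e w p a u y → p ℚ.* quotCoeff a u e w y ≡ convolution (λ e' w' → coeffTerm e' w' (p , a , u)) e w y
quotCoeff≡convolution e w p a u y = sym (begin
  convolution (λ e' w' → coeffTerm e' w' (p , a , u)) e w y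
    ≡⟨ sumℚ-cong (splitsℕ e) (λ n → sumℚ-cong (splitsList w) (λ m →
         trans (when-*ʳ _ p _) (when-∧ (a ≡ᵇ proj₁ n) (eqListᵇ u (proj₁ m)) _))) ⟩
  sumℚ (splitsℕ e) (λ n → sumℚ (splitsList w) (λ m →
      when (a ≡ᵇ proj₁ n) (when (eqListᵇ u (proj₁ m)) (p ℚ.* coeff (proj₂ n) (proj₂ m) y))))
    ≡⟨ sumℚ-cong (splitsℕ e) (λ n → trans (sumℚ-when (a ≡ᵇ proj₁ n) (splitsList w) _)
         (cong (when (a ≡ᵇ proj₁ n)) (sumℚ-splitsList-select w u _))) ⟩
  sumℚ (splitsℕ e) (λ n → when (a ≡ᵇ proj₁ n) (when (isPrefixᵇ u w) (p ℚ.* coeff (proj₂ n) (drop (length u) w) y)))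
    ≡⟨ sumℚ-splitsℕ-select e a _ ⟩
  when (leᵇ a e) (when (isPrefixᵇ u w) (p ℚ.* coeff (e ∸ a) (drop (length u) w) y))
    ≡⟨ sym (trans (*-whenˡ (leᵇ a e) p _) (cong (when (leᵇ a e)) (*-whenˡ (isPrefixᵇ u w) p _))) ⟩
  p ℚ.* quotCoeff a u e w y ∎)
  where open ≡-Reasoning

coeff-*S : ∀ e w x y → coeff e w (x *S y) ≡ convolution (λ e' w' → coeff e' w' x) e w y
coeff-*S e w [] y = sym (trans (sumℚ-cong (splitsℕ e) (λ n →
  trans (sumℚ-cong (splitsList w) (λ m → ℚP.*-zeroˡ (coeff (proj₂ n) (proj₂ m) y))) (sumℚ-zero (splitsList w))))
  (sumℚ-zero (splitsℕ e)))
coeff-*S e w (t@(p , a , u) ∷ x) y = begin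
  coeff e w (map (mulTerm t) y ++ x *S y)               ≡⟨ coeff-++ e w (map (mulTerm t) y) (x *S y) ⟩
  coeff e w (map (mulTerm t) y) ℚ.+ coeff e w (x *S y)
    ≡⟨ cong₂ ℚ._+_ (trans (coeff-map-mulTerm e w p a u y) (quotCoeff≡convolution e w p a u y)) (coeff-*S e w x y) ⟩
  convolution (λ e' w' → coeffTerm e' w' t) e w y ℚ.+ convolution (λ e' w' → coeff e' w' x) e w y
    ≡⟨ sym (sumℚ-+ (splitsℕ e) _ _) ⟩
  _ ≡⟨ sumℚ-cong (splitsℕ e) (λ n → trans (sym (sumℚ-+ (splitsList w) _ _))
         (sumℚ-cong (splitsList w) (λ m → sym (ℚP.*-distribʳ-+ _ (coeffTerm (proj₁ n) (proj₁ m) t) _)))) ⟩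
  convolution (λ e' w' → coeff e' w' (t ∷ x)) e w y ∎
  where open ≡-Reasoning

-- Sym[t] up to equality of all coefficients

-- A record rather than Defs' _≈_ itself, so that both sides stay inferable.
infix 4 _≋_
record _≋_ (x y : SymT) : Set where
  constructor mk≋
  field get : x ≈ y
open _≋_ public

≋-refl : ∀ {x} → x ≋ x
≋-refl = mk≋ (λ e w → refl)

≋-sym : ∀ {x y} → x ≋ y → y ≋ x
≋-sym (mk≋ p) = mk≋ (λ e w → sym (p e w))

≋-trans : ∀ {x y z} → x ≋ y → y ≋ z → x ≋ z
≋-trans (mk≋ p) (mk≋ q) = mk≋ (λ e w → trans (p e w) (q e w))

≡⇒≋ : ∀ {x y} → x ≡ y → x ≋ y
≡⇒≋ refl = ≋-refl

≋-setoid : Setoid _ _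
≋-setoid = record
  { Carrier = SymT ; _≈_ = _≋_
  ; isEquivalence = record { refl = ≋-refl ; sym = ≋-sym ; trans = ≋-trans } }

module ≋-Reasoning = SetoidR ≋-setoid

++-cong : ∀ {x x' y y'} → x ≋ x' → y ≋ y' → x ++ y ≋ x' ++ y'
++-cong {x} {x'} {y} {y'} (mk≋ p) (mk≋ q) = mk≋ (λ e w →
  trans (coeff-++ e w x y) (trans (cong₂ ℚ._+_ (p e w) (q e w)) (sym (coeff-++ e w x' y'))))

++-congˡ : ∀ x {y y'} → y ≋ y' → x ++ y ≋ x ++ y'
++-congˡ x = ++-cong (≋-refl {x})

++-comm-≋ : ∀ x y → x ++ y ≋ y ++ x
++-comm-≋ x y = mk≋ (λ e w →
  trans (coeff-++ e w x y) (trans (ℚP.+-comm (coeff e w x) (coeff e w y)) (sym (coeff-++ e w y x))))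

++-interchange-≋ : ∀ a b c d → (a ++ b) ++ (c ++ d) ≋ (a ++ c) ++ (b ++ d)
++-interchange-≋ a b c d = mk≋ (λ e w → begin
  coeff e w ((a ++ b) ++ (c ++ d))
    ≡⟨ trans (coeff-++ e w (a ++ b) (c ++ d)) (cong₂ ℚ._+_ (coeff-++ e w a b) (coeff-++ e w c d)) ⟩
  _ ≡⟨ +-interchange (coeff e w a) (coeff e w b) (coeff e w c) (coeff e w d) ⟩
  _ ≡⟨ sym (trans (coeff-++ e w (a ++ c) (b ++ d)) (cong₂ ℚ._+_ (coeff-++ e w a c) (coeff-++ e w b d))) ⟩
  coeff e w ((a ++ c) ++ (b ++ d)) ∎)
  where open ≡-Reasoning

++-identityˡ-≋ : ∀ {x y} → x ≋ [] → x ++ y ≋ y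
++-identityˡ-≋ {x} {y} (mk≋ p) = mk≋ (λ e w →
  trans (coeff-++ e w x y) (trans (cong (ℚ._+ coeff e w y) (p e w)) (ℚP.+-identityˡ _)))

++-identityʳ-≋ : ∀ {x y} → y ≋ [] → x ++ y ≋ x
++-identityʳ-≋ {x} {y} p = ≋-trans (++-comm-≋ x y) (++-identityˡ-≋ p)

++-cancelʳ-≋ : ∀ {x y z} → x ++ z ≋ y ++ z → x ≋ y
++-cancelʳ-≋ {x} {y} {z} (mk≋ p) = mk≋ (λ e w → GroupProperties.∙-cancelʳ ℚP.+-0-group (coeff e w z) _ _
  (trans (sym (coeff-++ e w x z)) (trans (p e w) (coeff-++ e w y z))))

*S-cong : ∀ {x x' y y'} → x ≋ x' → y ≋ y' → x *S y ≋ x' *S y'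
*S-cong {x} {x'} {y} {y'} (mk≋ p) (mk≋ q) = mk≋ (λ e w → trans (coeff-*S e w x y) (trans
  (sumℚ-cong (splitsℕ e) (λ n → sumℚ-cong (splitsList w) (λ m → cong₂ ℚ._*_ (p _ _) (q _ _))))
  (sym (coeff-*S e w x' y'))))

*S-congˡ : ∀ x {y y'} → y ≋ y' → x *S y ≋ x *S y'
*S-congˡ x = *S-cong (≋-refl {x})

*S-zeroʳ : ∀ y → y *S [] ≡ []
*S-zeroʳ []      = refl
*S-zeroʳ (t ∷ y) = *S-zeroʳ y

*S-distribʳ : ∀ x x' y → (x ++ x') *S y ≡ x *S y ++ x' *S y
*S-distribʳ x x' y = LP.concatMap-++ _ x x'

*S-distribˡ : ∀ x y y' → x *S (y ++ y') ≋ x *S y ++ x *S y'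
*S-distribˡ x y y' = mk≋ λ e w → begin
  coeff e w (x *S (y ++ y')) ≡⟨ coeff-*S e w x (y ++ y') ⟩
  _ ≡⟨ sumℚ-cong (splitsℕ e) (λ n → sumℚ-cong (splitsList w) (λ m →
        trans (cong (coeff (proj₁ n) (proj₁ m) x ℚ.*_) (coeff-++ (proj₂ n) (proj₂ m) y y'))
          (ℚP.*-distribˡ-+ (coeff (proj₁ n) (proj₁ m) x) _ _))) ⟩
  _ ≡⟨ sumℚ-cong (splitsℕ e) (λ n → sumℚ-+ (splitsList w) _ _) ⟩
  _ ≡⟨ sumℚ-+ (splitsℕ e) _ _ ⟩
  _ ≡⟨ sym (cong₂ ℚ._+_ (coeff-*S e w x y) (coeff-*S e w x y')) ⟩
  coeff e w (x *S y) ℚ.+ coeff e w (x *S y') ≡⟨ sym (coeff-++ e w (x *S y) (x *S y')) ⟩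
  coeff e w (x *S y ++ x *S y') ∎
  where open ≡-Reasoning

mulTerm-assoc : ∀ t s r → mulTerm (mulTerm t s) r ≡ mulTerm t (mulTerm s r)
mulTerm-assoc (p , a , u) (q , b , v) (c , d , z) =
  cong₂ _,_ (ℚP.*-assoc p q c) (cong₂ _,_ (ℕP.+-assoc a b d) (LP.++-assoc u v z))

map-mulTerm-*S : ∀ t y z → map (mulTerm t) y *S z ≡ map (mulTerm t) (y *S z)
map-mulTerm-*S t []      z = refl
map-mulTerm-*S t (s ∷ y) z = begin
  map (mulTerm (mulTerm t s)) z ++ map (mulTerm t) y *S z
    ≡⟨ cong₂ _++_ (trans (LP.map-cong (mulTerm-assoc t s) z) (LP.map-∘ z)) (map-mulTerm-*S t y z) ⟩
  map (mulTerm t) (map (mulTerm s) z) ++ map (mulTerm t) (y *S z)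
    ≡⟨ sym (LP.map-++ (mulTerm t) (map (mulTerm s) z) (y *S z)) ⟩
  map (mulTerm t) (map (mulTerm s) z ++ y *S z) ∎
  where open ≡-Reasoning

*S-assoc : ∀ x y z → (x *S y) *S z ≡ x *S (y *S z)
*S-assoc []      y z = refl
*S-assoc (t ∷ x) y z = begin
  (map (mulTerm t) y ++ x *S y) *S z          ≡⟨ *S-distribʳ (map (mulTerm t) y) (x *S y) z ⟩
  map (mulTerm t) y *S z ++ (x *S y) *S z     ≡⟨ cong₂ _++_ (map-mulTerm-*S t y z) (*S-assoc x y z) ⟩
  map (mulTerm t) (y *S z) ++ x *S (y *S z)   ∎
  where open ≡-Reasoning

*S-identityˡ : ∀ x → oneS *S x ≡ x
*S-identityˡ x = trans (LP.++-identityʳ _)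
  (trans (LP.map-cong (λ { (q , b , v) → cong (_, b , v) (ℚP.*-identityˡ q) }) x) (LP.map-id x))

*S-identityʳ : ∀ x → x *S oneS ≡ x
*S-identityʳ []              = refl
*S-identityʳ ((p , a , u) ∷ x) =
  cong₂ _∷_ (cong₂ _,_ (ℚP.*-identityʳ p) (cong₂ _,_ (ℕP.+-identityʳ a) (LP.++-identityʳ u))) (*S-identityʳ x)

-- c t^k, a central element of Sym[t]
tMonomial : ℚ → ℕ → SymT
tMonomial c k = (c , k , []) ∷ []

scale≡tMonomial-*S : ∀ c x → scale c x ≡ tMonomial c 0 *S x
scale≡tMonomial-*S c x = sym (LP.++-identityʳ _)

tpow≡tMonomial-*S : ∀ k x → tpow k x ≡ tMonomial 1ℚ k *S x
tpow≡tMonomial-*S k x = sym (trans (LP.++-identityʳ _)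
  (LP.map-cong (λ { (q , b , v) → cong (_, k ℕ.+ b , v) (ℚP.*-identityˡ q) }) x))

mulTerm-tMonomial-comm : ∀ c k t s → mulTerm t (mulTerm (c , k , []) s) ≡ mulTerm (c , k , []) (mulTerm t s)
mulTerm-tMonomial-comm c k (p , a , u) (q , b , v) =
  cong₂ _,_ (ℚ-*.x∙yz≈y∙xz p c q) (cong (_, u ++ v) (ℕ-+.x∙yz≈y∙xz a k b))
  where
  module ℚ-* = CommSemigroupProperties (CommutativeMonoid.commutativeSemigroup ℚP.*-1-commutativeMonoid)
  module ℕ-+ = CommSemigroupProperties ℕP.+-commutativeSemigroup

*S-tMonomial-comm : ∀ c k x y → x *S (tMonomial c k *S y) ≡ tMonomial c k *S (x *S y)
*S-tMonomial-comm c k x y = trans (cong (x *S_) (LP.++-identityʳ _))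
  (trans (commute x) (sym (LP.++-identityʳ _)))
  where
  commute : ∀ x → x *S map (mulTerm (c , k , [])) y ≡ map (mulTerm (c , k , [])) (x *S y)
  commute []      = refl
  commute (t ∷ x) = trans
    (cong₂ _++_ (trans (sym (LP.map-∘ y)) (trans (LP.map-cong (mulTerm-tMonomial-comm c k t) y) (LP.map-∘ y))) (commute x))
    (sym (LP.map-++ (mulTerm (c , k , [])) (map (mulTerm t) y) (x *S y)))

coeff-scale : ∀ e w c x → coeff e w (scale c x) ≡ c ℚ.* coeff e w x
coeff-scale e w c []                = sym (ℚP.*-zeroʳ c)
coeff-scale e w c ((q , a , u) ∷ x) =
  trans (cong₂ ℚ._+_ (sym (*-whenˡ ((a ≡ᵇ e) ∧ eqListᵇ u w) c q)) (coeff-scale e w c x)) (sym (ℚP.*-distribˡ-+ c _ _))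

scale-cong : ∀ a {x y} → x ≋ y → scale a x ≋ scale a y
scale-cong a {x} {y} (mk≋ p) = mk≋ (λ e w →
  trans (coeff-scale e w a x) (trans (cong (a ℚ.*_) (p e w)) (sym (coeff-scale e w a y))))

scale-scale : ∀ a b x → scale a (scale b x) ≡ scale (a ℚ.* b) x
scale-scale a b x = trans (sym (LP.map-∘ x)) (LP.map-cong (λ { (q , c , u) → cong (_, c , u) (sym (ℚP.*-assoc a b q)) }) x)

scale-identity : ∀ x → scale 1ℚ x ≡ x
scale-identity x = trans (LP.map-cong (λ { (q , c , u) → cong (_, c , u) (ℚP.*-identityˡ q) }) x) (LP.map-id x)

neg : SymT → SymT
neg = scale (ℚ.- 1ℚ)

++-inverseʳ-≋ : ∀ x → x ++ neg x ≋ []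
++-inverseʳ-≋ x = mk≋ (λ e w → begin
  coeff e w (x ++ neg x)                     ≡⟨ coeff-++ e w x (neg x) ⟩
  coeff e w x ℚ.+ coeff e w (neg x)          ≡⟨ cong (coeff e w x ℚ.+_) (coeff-scale e w (ℚ.- 1ℚ) x) ⟩
  coeff e w x ℚ.+ ℚ.- 1ℚ ℚ.* coeff e w x     ≡⟨ cong (coeff e w x ℚ.+_) (sym (ℚP.neg-distribˡ-* 1ℚ (coeff e w x))) ⟩
  coeff e w x ℚ.+ ℚ.- (1ℚ ℚ.* coeff e w x)   ≡⟨ cong (λ z → coeff e w x ℚ.+ ℚ.- z) (ℚP.*-identityˡ (coeff e w x)) ⟩
  coeff e w x ℚ.+ ℚ.- coeff e w x            ≡⟨ ℚP.+-inverseʳ (coeff e w x) ⟩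
  0ℚ                                         ∎)
  where open ≡-Reasoning

tpow-cong : ∀ k {x y} → x ≋ y → tpow k x ≋ tpow k y
tpow-cong k {x} {y} x≋y = ≋-trans (≡⇒≋ (tpow≡tMonomial-*S k x))
  (≋-trans (*S-congˡ (tMonomial 1ℚ k) x≋y) (≡⇒≋ (sym (tpow≡tMonomial-*S k y))))

tpow-zero : ∀ x → tpow 0 x ≡ x
tpow-zero = LP.map-id

-- Finite sums

sumOver : ∀ {A : Set} → List A → (A → SymT) → SymT
sumOver []       f = []
sumOver (x ∷ xs) f = f x ++ sumOver xs f

sumS-map≡sumOver : ∀ {A : Set} (xs : List A) (f : A → SymT) → sumS (map f xs) ≡ sumOver xs f
sumS-map≡sumOver []       f = refl
sumS-map≡sumOver (x ∷ xs) f = cong (f x ++_) (sumS-map≡sumOver xs f)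

map≡sumOver : ∀ {A : Set} (g : A → Term) xs → map g xs ≡ sumOver xs (λ x → g x ∷ [])
map≡sumOver g []       = refl
map≡sumOver g (x ∷ xs) = cong (g x ∷_) (map≡sumOver g xs)

sumOver-cong∈ : ∀ {A : Set} (xs : List A) {f g : A → SymT} → (∀ x → x ∈ xs → f x ≋ g x) → sumOver xs f ≋ sumOver xs g
sumOver-cong∈ []       f≋g = ≋-refl
sumOver-cong∈ (x ∷ xs) f≋g = ++-cong (f≋g x (here refl)) (sumOver-cong∈ xs (λ y y∈ → f≋g y (there y∈)))

sumOver-cong : ∀ {A : Set} (xs : List A) {f g : A → SymT} → (∀ x → f x ≋ g x) → sumOver xs f ≋ sumOver xs g
sumOver-cong xs f≋g = sumOver-cong∈ xs (λ x _ → f≋g x)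

sumOver-≋[] : ∀ {A : Set} (xs : List A) {f : A → SymT} → (∀ x → f x ≋ []) → sumOver xs f ≋ []
sumOver-≋[] []       f≋[] = ≋-refl
sumOver-≋[] (x ∷ xs) f≋[] = ≋-trans (++-identityˡ-≋ (f≋[] x)) (sumOver-≋[] xs f≋[])

sumOver-++ : ∀ {A : Set} (xs ys : List A) (f : A → SymT) → sumOver (xs ++ ys) f ≡ sumOver xs f ++ sumOver ys f
sumOver-++ []       ys f = refl
sumOver-++ (x ∷ xs) ys f = trans (cong (f x ++_) (sumOver-++ xs ys f)) (sym (LP.++-assoc (f x) (sumOver xs f) (sumOver ys f)))

sumOver-+ : ∀ {A : Set} (xs : List A) (f g : A → SymT) → sumOver xs (λ x → f x ++ g x) ≋ sumOver xs f ++ sumOver xs g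
sumOver-+ []       f g = ≋-refl
sumOver-+ (x ∷ xs) f g =
  ≋-trans (++-congˡ (f x ++ g x) (sumOver-+ xs f g)) (++-interchange-≋ (f x) (g x) (sumOver xs f) (sumOver xs g))

sumOver-*ʳ : ∀ {A : Set} (xs : List A) (f : A → SymT) y → sumOver xs f *S y ≡ sumOver xs (λ x → f x *S y)
sumOver-*ʳ []       f y = refl
sumOver-*ʳ (x ∷ xs) f y = trans (*S-distribʳ (f x) (sumOver xs f) y) (cong (f x *S y ++_) (sumOver-*ʳ xs f y))

sumOver-*ˡ : ∀ {A : Set} (xs : List A) (f : A → SymT) y → y *S sumOver xs f ≋ sumOver xs (λ x → y *S f x)
sumOver-*ˡ []       f y = ≡⇒≋ (*S-zeroʳ y)
sumOver-*ˡ (x ∷ xs) f y = ≋-trans (*S-distribˡ y (f x) (sumOver xs f)) (++-congˡ (y *S f x) (sumOver-*ˡ xs f y))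

sumOver-map : ∀ {A B : Set} (xs : List A) (g : A → B) (f : B → SymT) → sumOver (map g xs) f ≡ sumOver xs (f ∘ g)
sumOver-map []       g f = refl
sumOver-map (x ∷ xs) g f = cong (f (g x) ++_) (sumOver-map xs g f)

sumOver-concatMap : ∀ {A B : Set} (xs : List A) (g : A → List B) (f : B → SymT) →
  sumOver (concatMap g xs) f ≡ sumOver xs (λ x → sumOver (g x) f)
sumOver-concatMap []       g f = refl
sumOver-concatMap (x ∷ xs) g f =
  trans (sumOver-++ (g x) (concatMap g xs) f) (cong (sumOver (g x) f ++_) (sumOver-concatMap xs g f))

sumOver-↭ : ∀ {A : Set} {xs ys : List A} (f : A → SymT) → xs ↭ ys → sumOver xs f ≋ sumOver ys f
sumOver-↭ f ↭.refl                            = ≋-refl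
sumOver-↭ f (↭.prep x p)                      = ++-congˡ (f x) (sumOver-↭ f p)
sumOver-↭ f (↭.swap {xs = xs} {ys = ys} x y p) = ≋-trans (≡⇒≋ (sym (LP.++-assoc (f x) (f y) (sumOver xs f))))
  (≋-trans (++-cong (++-comm-≋ (f x) (f y)) (sumOver-↭ f p)) (≡⇒≋ (LP.++-assoc (f y) (f x) (sumOver ys f))))
sumOver-↭ f (↭.trans p q)                     = ≋-trans (sumOver-↭ f p) (sumOver-↭ f q)

scale-sumOver : ∀ {A : Set} a (xs : List A) f → scale a (sumOver xs f) ≡ sumOver xs (λ x → scale a (f x))
scale-sumOver a []       f = refl
scale-sumOver a (x ∷ xs) f = trans (LP.map-++ _ (f x) (sumOver xs f)) (cong (scale a (f x) ++_) (scale-sumOver a xs f))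

tpow-sumOver : ∀ {A : Set} k (xs : List A) f → tpow k (sumOver xs f) ≡ sumOver xs (λ x → tpow k (f x))
tpow-sumOver k []       f = refl
tpow-sumOver k (x ∷ xs) f = trans (LP.map-++ _ (f x) (sumOver xs f)) (cong (tpow k (f x) ++_) (tpow-sumOver k xs f))

sumBelow : ℕ → (ℕ → SymT) → SymT
sumBelow zero    f = []
sumBelow (suc n) f = f 0 ++ sumBelow n (f ∘ suc)

sumBelow≡sumOver-upTo : ∀ n f → sumBelow n f ≡ sumOver (upTo n) f
sumBelow≡sumOver-upTo n f = sym (sumOver-applyUpTo id n)
  where
  sumOver-applyUpTo : ∀ (g : ℕ → ℕ) n → sumOver (applyUpTo g n) f ≡ sumBelow n (f ∘ g)
  sumOver-applyUpTo g zero    = refl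
  sumOver-applyUpTo g (suc n) = cong (f (g 0) ++_) (sumOver-applyUpTo (g ∘ suc) n)

sumBelow-cong< : ∀ n {f g : ℕ → SymT} → (∀ i → i < n → f i ≋ g i) → sumBelow n f ≋ sumBelow n g
sumBelow-cong< zero    f≋g = ≋-refl
sumBelow-cong< (suc n) f≋g = ++-cong (f≋g 0 (s≤s z≤n)) (sumBelow-cong< n (λ i i<n → f≋g (suc i) (s≤s i<n)))

sumBelow-cong : ∀ n {f g : ℕ → SymT} → (∀ i → f i ≋ g i) → sumBelow n f ≋ sumBelow n g
sumBelow-cong n f≋g = sumBelow-cong< n (λ i _ → f≋g i)

sumBelow-≋[] : ∀ n {f : ℕ → SymT} → (∀ i → i < n → f i ≋ []) → sumBelow n f ≋ []
sumBelow-≋[] zero    f≋[] = ≋-refl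
sumBelow-≋[] (suc n) f≋[] = ≋-trans (++-identityˡ-≋ (f≋[] 0 (s≤s z≤n))) (sumBelow-≋[] n (λ i i<n → f≋[] (suc i) (s≤s i<n)))

sumBelow-suc-last : ∀ n f → sumBelow (suc n) f ≡ sumBelow n f ++ f n
sumBelow-suc-last zero    f = LP.++-identityʳ (f 0)
sumBelow-suc-last (suc n) f =
  trans (cong (f 0 ++_) (sumBelow-suc-last n (f ∘ suc))) (sym (LP.++-assoc (f 0) (sumBelow n (f ∘ suc)) (f (suc n))))

sumBelow-+-split : ∀ a b f → sumBelow (a ℕ.+ b) f ≡ sumBelow a f ++ sumBelow b (λ j → f (a ℕ.+ j))
sumBelow-+-split zero    b f = refl
sumBelow-+-split (suc a) b f =
  trans (cong (f 0 ++_) (sumBelow-+-split a b (f ∘ suc))) (sym (LP.++-assoc (f 0) (sumBelow a (f ∘ suc)) _))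

sumBelow-+ : ∀ n (f g : ℕ → SymT) → sumBelow n (λ i → f i ++ g i) ≋ sumBelow n f ++ sumBelow n g
sumBelow-+ zero    f g = ≋-refl
sumBelow-+ (suc n) f g =
  ≋-trans (++-congˡ (f 0 ++ g 0) (sumBelow-+ n (f ∘ suc) (g ∘ suc))) (++-interchange-≋ (f 0) (g 0) _ _)

sumBelow-*ʳ : ∀ n (f : ℕ → SymT) y → sumBelow n f *S y ≡ sumBelow n (λ i → f i *S y)
sumBelow-*ʳ zero    f y = refl
sumBelow-*ʳ (suc n) f y =
  trans (*S-distribʳ (f 0) (sumBelow n (f ∘ suc)) y) (cong (f 0 *S y ++_) (sumBelow-*ʳ n (f ∘ suc) y))

sumBelow-*ˡ : ∀ n (f : ℕ → SymT) y → y *S sumBelow n f ≋ sumBelow n (λ i → y *S f i)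
sumBelow-*ˡ zero    f y = ≡⇒≋ (*S-zeroʳ y)
sumBelow-*ˡ (suc n) f y =
  ≋-trans (*S-distribˡ y (f 0) (sumBelow n (f ∘ suc))) (++-congˡ (y *S f 0) (sumBelow-*ˡ n (f ∘ suc) y))

scale-sumBelow : ∀ a n f → scale a (sumBelow n f) ≡ sumBelow n (λ i → scale a (f i))
scale-sumBelow a zero    f = refl
scale-sumBelow a (suc n) f =
  trans (LP.map-++ _ (f 0) (sumBelow n (f ∘ suc))) (cong (scale a (f 0) ++_) (scale-sumBelow a n (f ∘ suc)))

sumBelow-triangle : ∀ k (g : ℕ → ℕ → SymT) →
  sumBelow (suc k) (λ i → sumBelow (suc i) (λ p → g p (i ∸ p))) ≋ sumBelow (suc k) (λ p → sumBelow (suc (k ∸ p)) (g p))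
sumBelow-triangle zero    g = ≋-refl
sumBelow-triangle (suc k) g = begin
  sumBelow (suc (suc k)) diagonal                             ≡⟨ sumBelow-suc-last (suc k) diagonal ⟩
  sumBelow (suc k) diagonal ++ diagonal (suc k)                ≈⟨ ++-cong (sumBelow-triangle k g) lastDiagonal ⟩
  sumBelow (suc k) column ++ (sumBelow (suc k) newCell ++ g (suc k) 0)
    ≡⟨ sym (LP.++-assoc (sumBelow (suc k) column) (sumBelow (suc k) newCell) (g (suc k) 0)) ⟩
  (sumBelow (suc k) column ++ sumBelow (suc k) newCell) ++ g (suc k) 0
    ≈⟨ ++-cong (≋-sym (sumBelow-+ (suc k) column newCell)) ≋-refl ⟩
  sumBelow (suc k) (λ p → column p ++ newCell p) ++ g (suc k) 0
    ≈⟨ ++-cong (sumBelow-cong< (suc k) (λ p p≤k → ≡⇒≋ (sym (extendColumn p (ℕP.≤-pred p≤k)))))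
               (≡⇒≋ (trans (sym (LP.++-identityʳ _)) (cong (λ z → sumBelow (suc z) (g (suc k))) (sym (ℕP.n∸n≡0 k))))) ⟩
  sumBelow (suc k) (λ p → sumBelow (suc (suc k ∸ p)) (g p)) ++ sumBelow (suc (suc k ∸ suc k)) (g (suc k))
    ≡⟨ sym (sumBelow-suc-last (suc k) (λ p → sumBelow (suc (suc k ∸ p)) (g p))) ⟩
  sumBelow (suc (suc k)) (λ p → sumBelow (suc (suc k ∸ p)) (g p)) ∎
  where
  open ≋-Reasoning
  diagonal = λ i → sumBelow (suc i) (λ p → g p (i ∸ p))
  column   = λ p → sumBelow (suc (k ∸ p)) (g p)
  newCell  = λ p → g p (suc k ∸ p)
  lastDiagonal : diagonal (suc k) ≋ sumBelow (suc k) newCell ++ g (suc k) 0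
  lastDiagonal = ≡⇒≋ (trans (sumBelow-suc-last (suc k) newCell) (cong (λ z → sumBelow (suc k) newCell ++ g (suc k) z) (ℕP.n∸n≡0 k)))
  extendColumn : ∀ p → p ≤ k → sumBelow (suc (suc k ∸ p)) (g p) ≡ column p ++ newCell p
  extendColumn p p≤k rewrite ℕP.+-∸-assoc 1 p≤k = sumBelow-suc-last (suc (k ∸ p)) (g p)

-- Signs and the signed monomials  term s e K = (-1)^(s+e) t^e Λ^K

sgn-+ : ∀ m n → sgn (m ℕ.+ n) ≡ sgn m ℚ.* sgn n
sgn-+ zero    n = sym (ℚP.*-identityˡ (sgn n))
sgn-+ (suc m) n = trans (cong ℚ.-_ (sgn-+ m n)) (ℚP.neg-distribˡ-* (sgn m) (sgn n))

sgn-*-sgn : ∀ b → sgn b ℚ.* sgn b ≡ 1ℚ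
sgn-*-sgn zero    = refl
sgn-*-sgn (suc b) = trans (sym (ℚP.neg-distribˡ-* (sgn b) (ℚ.- sgn b)))
  (trans (cong ℚ.-_ (sym (ℚP.neg-distribʳ-* (sgn b) (sgn b)))) (trans (GroupProperties.⁻¹-involutive ℚP.+-0-group _) (sgn-*-sgn b)))

sgn-+-double : ∀ a b → sgn (a ℕ.+ (b ℕ.+ b)) ≡ sgn a
sgn-+-double a b = trans (sgn-+ a (b ℕ.+ b))
  (trans (cong (sgn a ℚ.*_) (trans (sgn-+ b b) (sgn-*-sgn b))) (ℚP.*-identityʳ (sgn a)))

sgn-∸ : ∀ a b → b ≤ a → sgn (a ∸ b) ≡ sgn (a ℕ.+ b)
sgn-∸ a b b≤a = sym (trans (cong sgn a+b≡) (sgn-+-double (a ∸ b) b))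
  where
  a+b≡ : a ℕ.+ b ≡ (a ∸ b) ℕ.+ (b ℕ.+ b)
  a+b≡ = trans (cong (ℕ._+ b) (sym (ℕP.m∸n+n≡m b≤a))) (ℕP.+-assoc (a ∸ b) b b)

sgn-∸-split : ∀ {k i l} → i ≤ k → l ≤ k ∸ i → sgn (k ∸ l) ≡ sgn i ℚ.* sgn ((k ∸ i) ∸ l)
sgn-∸-split {k} {i} {l} i≤k l≤k∸i = begin
  sgn (k ∸ l)                   ≡⟨ sgn-∸ k l (ℕP.≤-trans l≤k∸i (ℕP.m∸n≤m k i)) ⟩
  sgn (k ℕ.+ l)                 ≡⟨ cong (λ z → sgn (z ℕ.+ l)) (sym (ℕP.m+[n∸m]≡n i≤k)) ⟩
  sgn ((i ℕ.+ (k ∸ i)) ℕ.+ l)   ≡⟨ trans (cong sgn (ℕP.+-assoc i (k ∸ i) l)) (sgn-+ i _) ⟩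
  sgn i ℚ.* sgn ((k ∸ i) ℕ.+ l) ≡⟨ cong (sgn i ℚ.*_) (sym (sgn-∸ (k ∸ i) l l≤k∸i)) ⟩
  sgn i ℚ.* sgn ((k ∸ i) ∸ l)   ∎
  where open ≡-Reasoning

scale-sgn-suc : ∀ q y → scale (sgn (suc q)) y ≡ neg (scale (sgn q) y)
scale-sgn-suc q y = trans (cong (λ z → scale z y) (trans (cong ℚ.-_ (sym (ℚP.*-identityˡ (sgn q)))) (ℚP.neg-distribˡ-* 1ℚ (sgn q))))
  (sym (scale-scale (ℚ.- 1ℚ) (sgn q) y))

ΛJ-++ : ∀ K L → ΛJ (K ++ L) ≡ ΛJ K *S ΛJ L
ΛJ-++ []      L = sym (*S-identityˡ (ΛJ L))
ΛJ-++ (k ∷ K) L = trans (cong (Λ k *S_) (ΛJ-++ K L)) (sym (*S-assoc (Λ k) (ΛJ K) (ΛJ L)))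

term≡tMonomial-*S-ΛJ : ∀ s e K → term s e K ≡ tMonomial (sgn (s ℕ.+ e)) e *S ΛJ K
term≡tMonomial-*S-ΛJ s e K = begin
  scale σ (tpow e (ΛJ K))                       ≡⟨ scale≡tMonomial-*S σ (tpow e (ΛJ K)) ⟩
  tMonomial σ 0 *S tpow e (ΛJ K)                ≡⟨ cong (tMonomial σ 0 *S_) (tpow≡tMonomial-*S e (ΛJ K)) ⟩
  tMonomial σ 0 *S (tMonomial 1ℚ e *S ΛJ K)     ≡⟨ sym (*S-assoc (tMonomial σ 0) (tMonomial 1ℚ e) (ΛJ K)) ⟩
  tMonomial (σ ℚ.* 1ℚ) e *S ΛJ K               ≡⟨ cong (λ z → tMonomial z e *S ΛJ K) (ℚP.*-identityʳ σ) ⟩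
  tMonomial σ e *S ΛJ K                        ∎
  where
  open ≡-Reasoning
  σ = sgn (s ℕ.+ e)

term-sgn-cong : ∀ s s' e K → sgn (s ℕ.+ e) ≡ sgn (s' ℕ.+ e) → term s e K ≡ term s' e K
term-sgn-cong s s' e K eq = cong (λ z → scale z (tpow e (ΛJ K))) eq

term-*S : ∀ s e K s' e' L → term s e K *S term s' e' L ≡ term (s ℕ.+ s') (e ℕ.+ e') (K ++ L)
term-*S s e K s' e' L = begin
  term s e K *S term s' e' L                          ≡⟨ cong₂ _*S_ (term≡tMonomial-*S-ΛJ s e K) (term≡tMonomial-*S-ΛJ s' e' L) ⟩
  (tMonomial σ e *S ΛJ K) *S (tMonomial σ' e' *S ΛJ L) ≡⟨ *S-assoc (tMonomial σ e) (ΛJ K) _ ⟩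
  tMonomial σ e *S (ΛJ K *S (tMonomial σ' e' *S ΛJ L)) ≡⟨ cong (tMonomial σ e *S_) (*S-tMonomial-comm σ' e' (ΛJ K) (ΛJ L)) ⟩
  tMonomial σ e *S (tMonomial σ' e' *S (ΛJ K *S ΛJ L)) ≡⟨ sym (*S-assoc (tMonomial σ e) (tMonomial σ' e') _) ⟩
  tMonomial (σ ℚ.* σ') (e ℕ.+ e') *S (ΛJ K *S ΛJ L)
    ≡⟨ cong₂ (λ z Z → tMonomial z (e ℕ.+ e') *S Z) sgn-product (sym (ΛJ-++ K L)) ⟩
  tMonomial (sgn ((s ℕ.+ s') ℕ.+ (e ℕ.+ e'))) (e ℕ.+ e') *S ΛJ (K ++ L)
    ≡⟨ sym (term≡tMonomial-*S-ΛJ (s ℕ.+ s') (e ℕ.+ e') (K ++ L)) ⟩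
  term (s ℕ.+ s') (e ℕ.+ e') (K ++ L) ∎
  where
  open ≡-Reasoning
  σ  = sgn (s ℕ.+ e)
  σ' = sgn (s' ℕ.+ e')
  sgn-product : σ ℚ.* σ' ≡ sgn ((s ℕ.+ s') ℕ.+ (e ℕ.+ e'))
  sgn-product = trans (sym (sgn-+ (s ℕ.+ e) (s' ℕ.+ e')))
    (cong sgn (CommSemigroupProperties.interchange ℕP.+-commutativeSemigroup s e s' e'))

Λ-*S-term : ∀ j s e K → Λ j *S term s e K ≡ term s e (j ∷ K)
Λ-*S-term j s e K = trans (cong (Λ j *S_) (term≡tMonomial-*S-ΛJ s e K))
  (trans (*S-tMonomial-comm (sgn (s ℕ.+ e)) e (Λ j) (ΛJ K)) (sym (term≡tMonomial-*S-ΛJ s e (j ∷ K))))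

scale-sgn-term : ∀ x s e K → scale (sgn x) (term s e K) ≡ term (x ℕ.+ s) e K
scale-sgn-term x s e K = begin
  scale (sgn x) (term s e K)                                  ≡⟨ scale-scale (sgn x) (sgn (s ℕ.+ e)) _ ⟩
  scale (sgn x ℚ.* sgn (s ℕ.+ e)) (tpow e (ΛJ K))             ≡⟨ cong (λ z → scale z (tpow e (ΛJ K))) (sym (sgn-+ x (s ℕ.+ e))) ⟩
  scale (sgn (x ℕ.+ (s ℕ.+ e))) (tpow e (ΛJ K))               ≡⟨ cong (λ z → scale (sgn z) (tpow e (ΛJ K))) (sym (ℕP.+-assoc x s e)) ⟩
  term (x ℕ.+ s) e K                                          ∎
  where open ≡-Reasoning

tpow-term : ∀ k s e K s' → sgn (s' ℕ.+ (k ℕ.+ e)) ≡ sgn (s ℕ.+ e) → tpow k (term s e K) ≡ term s' (k ℕ.+ e) K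
tpow-term k s e K s' same-sign = begin
  tpow k (term s e K)                                       ≡⟨ tpow≡tMonomial-*S k (term s e K) ⟩
  tMonomial 1ℚ k *S term s e K                              ≡⟨ cong (tMonomial 1ℚ k *S_) (term≡tMonomial-*S-ΛJ s e K) ⟩
  tMonomial 1ℚ k *S (tMonomial (sgn (s ℕ.+ e)) e *S ΛJ K)   ≡⟨ sym (*S-assoc (tMonomial 1ℚ k) (tMonomial (sgn (s ℕ.+ e)) e) (ΛJ K)) ⟩
  tMonomial (1ℚ ℚ.* sgn (s ℕ.+ e)) (k ℕ.+ e) *S ΛJ K
    ≡⟨ cong (λ z → tMonomial z (k ℕ.+ e) *S ΛJ K) (trans (ℚP.*-identityˡ _) (sym same-sign)) ⟩
  tMonomial (sgn (s' ℕ.+ (k ℕ.+ e))) (k ℕ.+ e) *S ΛJ K     ≡⟨ sym (term≡tMonomial-*S-ΛJ s' (k ℕ.+ e) K) ⟩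
  term s' (k ℕ.+ e) K                                       ∎
  where open ≡-Reasoning

term-suc-cancel : ∀ s e K → term (suc s) e K ++ term s e K ≋ []
term-suc-cancel s e K = mk≋ (λ e' w → begin
  coeff e' w (term (suc s) e K ++ term s e K)                ≡⟨ coeff-++ e' w (term (suc s) e K) (term s e K) ⟩
  coeff e' w (term (suc s) e K) ℚ.+ coeff e' w (term s e K)
    ≡⟨ cong₂ ℚ._+_ (coeff-scale e' w (sgn (suc s ℕ.+ e)) (tpow e (ΛJ K))) (coeff-scale e' w σ (tpow e (ΛJ K))) ⟩
  ℚ.- σ ℚ.* base e' w ℚ.+ σ ℚ.* base e' w                    ≡⟨ sym (ℚP.*-distribʳ-+ (base e' w) (ℚ.- σ) σ) ⟩
  (ℚ.- σ ℚ.+ σ) ℚ.* base e' w                                ≡⟨ cong (ℚ._* base e' w) (ℚP.+-inverseˡ σ) ⟩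
  0ℚ ℚ.* base e' w                                           ≡⟨ ℚP.*-zeroˡ (base e' w) ⟩
  0ℚ                                                         ∎)
  where
  open ≡-Reasoning
  σ = sgn (s ℕ.+ e)
  base = λ e' w → coeff e' w (tpow e (ΛJ K))

-- Compositions

IsComposition : ℕ → List ℕ → Set
IsComposition k c = All (1 ≤_) c × sumℕ c ≡ k

-- Each composition of n + 1 arises from one c of n as 1 ∷ c or by increasing the first part of c.
grow : List ℕ → List (List ℕ)
grow c = (1 ∷ c) ∷ incrFirst c

shrink : List ℕ → List ℕ
shrink (suc zero ∷ c)    = c
shrink (suc (suc x) ∷ c) = suc x ∷ c
shrink c                 = c

shrink-grow : ∀ {c v} → All (1 ≤_) c → v ∈ grow c → shrink v ≡ c
shrink-grow _                       (here refl)         = refl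
shrink-grow {suc x ∷ xs} (s≤s _ ∷ _) (there (here refl)) = refl

compositions-sound : ∀ k {c} → c ∈ compositions k → IsComposition k c
compositions-sound zero          (here refl) = [] , refl
compositions-sound (suc zero)    (here refl) = (s≤s z≤n ∷ []) , refl
compositions-sound (suc (suc n)) c∈ with find (∈-concatMap⁻ grow {xs = compositions (suc n)} c∈)
... | c' , c'∈ , here refl with compositions-sound (suc n) c'∈
...   | (ps , sum≡) = (s≤s z≤n ∷ ps) , cong suc sum≡
compositions-sound (suc (suc n)) c∈ | (x ∷ xs) , c'∈ , there (here refl) with compositions-sound (suc n) c'∈
...   | (p ∷ ps , sum≡) = (s≤s z≤n ∷ ps) , cong suc sum≡

sum≡0⇒[] : ∀ {c} → All (1 ≤_) c → sumℕ c ≡ 0 → c ≡ []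
sum≡0⇒[] []          _ = refl
sum≡0⇒[] (s≤s _ ∷ _) ()

compositions-complete : ∀ k c → IsComposition k c → c ∈ compositions k
compositions-complete zero          c                 (ps , sum≡) rewrite sum≡0⇒[] ps sum≡ = here refl
compositions-complete (suc k)       []                (_ , ())
compositions-complete (suc zero)    (suc zero ∷ c)    (_ ∷ ps , sum≡) rewrite sum≡0⇒[] ps (ℕP.suc-injective sum≡) = here refl
compositions-complete (suc zero)    (suc (suc x) ∷ c) (_ , ())
compositions-complete (suc (suc n)) (suc zero ∷ c)    (_ ∷ ps , sum≡) = ∈-concatMap⁺ grow
  (lose (compositions-complete (suc n) c (ps , ℕP.suc-injective sum≡)) (here refl))
compositions-complete (suc (suc n)) (suc (suc x) ∷ c) (_ ∷ ps , sum≡) = ∈-concatMap⁺ grow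
  (lose (compositions-complete (suc n) (suc x ∷ c) (s≤s z≤n ∷ ps , ℕP.suc-injective sum≡)) (there (here refl)))

Unique⇒AllPairs : ∀ {A : Set} {R : A → A → Set} (V : A → Set) {xs : List A} →
  Unique xs → All V xs → (∀ {x y} → V x → V y → x ≢ y → R x y) → AllPairs R xs
Unique⇒AllPairs V []         []         distinct⇒R = []
Unique⇒AllPairs V (x≢ ∷ uxs) (vx ∷ vxs) distinct⇒R =
  Allm.zipWith (λ (x≢y , vy) → distinct⇒R vx vy x≢y) (x≢ , vxs) ∷ Unique⇒AllPairs V uxs vxs distinct⇒R

compositions-unique : ∀ k → Unique (compositions k)
compositions-unique zero          = [] ∷ []
compositions-unique (suc zero)    = [] ∷ []
compositions-unique (suc (suc n)) = UP.concat⁺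
  (AllP.map⁺ (Allm.tabulate (λ {c} c∈ → grow-unique (proj₁ (compositions-sound (suc n) c∈)))))
  (APP.map⁺ (Unique⇒AllPairs (All (1 ≤_)) (compositions-unique (suc n))
     (Allm.tabulate (λ c∈ → proj₁ (compositions-sound (suc n) c∈))) grow-disjoint))
  where
  grow-unique : ∀ {c} → All (1 ≤_) c → Unique (grow c)
  grow-unique {[]}           _           = [] ∷ []
  grow-unique {suc x ∷ xs}   (s≤s _ ∷ _) = ((λ ()) ∷ []) ∷ [] ∷ []
  grow-disjoint : ∀ {c c'} → All (1 ≤_) c → All (1 ≤_) c' → c ≢ c' → Disjoint (grow c) (grow c')
  grow-disjoint pc pc' c≢c' (v∈ , v∈') = c≢c' (trans (sym (shrink-grow pc v∈)) (shrink-grow pc' v∈'))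

length≤sum : ∀ {c} → All (1 ≤_) c → length c ≤ sumℕ c
length≤sum []       = z≤n
length≤sum (p ∷ ps) = ℕP.+-mono-≤ p (length≤sum ps)

sumOver-compositions-suc : ∀ k (f : List ℕ → SymT) →
  sumOver (compositions (suc k)) f ≋ sumBelow (suc k) (λ i → sumOver (compositions (k ∸ i)) (λ c → f (suc i ∷ c)))
sumOver-compositions-suc zero    f = ≡⇒≋ (sym (LP.++-identityʳ (f (1 ∷ []) ++ [])))
sumOver-compositions-suc (suc k) f = begin
  sumOver (concatMap grow (compositions (suc k))) f
    ≡⟨ sumOver-concatMap (compositions (suc k)) grow f ⟩
  sumOver (compositions (suc k)) (λ c → f (1 ∷ c) ++ sumOver (incrFirst c) f)
    ≈⟨ sumOver-+ (compositions (suc k)) (λ c → f (1 ∷ c)) (λ c → sumOver (incrFirst c) f) ⟩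
  sumOver (compositions (suc k)) (λ c → f (1 ∷ c)) ++ sumOver (compositions (suc k)) (λ c → sumOver (incrFirst c) f)
    ≈⟨ ++-congˡ ones (sumOver-compositions-suc k (λ c → sumOver (incrFirst c) f)) ⟩
  sumOver (compositions (suc k)) (λ c → f (1 ∷ c)) ++ sumBelow (suc k) (λ i → sumOver (compositions (k ∸ i)) (λ c → f (suc (suc i) ∷ c) ++ []))
    ≈⟨ ++-congˡ ones (sumBelow-cong (suc k) (λ i → sumOver-cong (compositions (k ∸ i)) (λ c → ≡⇒≋ (LP.++-identityʳ (f (suc (suc i) ∷ c)))))) ⟩
  sumOver (compositions (suc k)) (λ c → f (1 ∷ c)) ++ sumBelow (suc k) (λ i → sumOver (compositions (k ∸ i)) (λ c → f (suc (suc i) ∷ c)))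
    ∎
  where
  open ≋-Reasoning
  ones = sumOver (compositions (suc k)) (λ c → f (1 ∷ c))

-- Type-B compositions

bcompsWithHead : ℕ → ℕ → List BComp
bcompsWithHead n i0 = map (i0 ,_) (compositions (n ∸ i0))

bcomps-sound : ∀ n J → J ∈ bcomps n → IsBComp n J
bcomps-sound n J J∈ with find (∈-concatMap⁻ (bcompsWithHead n) {xs = upTo (suc n)} J∈)
... | i0 , i0∈ , p with ∈-map⁻ (i0 ,_) p
...   | c , c∈ , refl with compositions-sound (n ∸ i0) c∈
...     | ps , sum≡ = ps , trans (cong (i0 ℕ.+_) sum≡) (ℕP.m+[n∸m]≡n (ℕP.≤-pred (∈-upTo⁻ i0∈)))

bcomps-complete : ∀ n J → IsBComp n J → J ∈ bcomps n
bcomps-complete n (i0 , c) (ps , sum≡) = ∈-concatMap⁺ (bcompsWithHead n)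
  (lose (∈-upTo⁺ (s≤s i0≤n)) (∈-map⁺ (i0 ,_) (compositions-complete (n ∸ i0) c (ps , sumc≡))))
  where
  i0≤n : i0 ≤ n
  i0≤n = subst (i0 ≤_) sum≡ (ℕP.m≤m+n i0 (sumℕ c))
  sumc≡ : sumℕ c ≡ n ∸ i0
  sumc≡ = trans (sym (ℕP.m+n∸m≡n i0 (sumℕ c))) (cong (_∸ i0) sum≡)

bcomps-unique : ∀ n → Unique (bcomps n)
bcomps-unique n = UP.concat⁺
  (AllP.map⁺ (Allm.universal (λ i0 → UP.map⁺ (λ eq → proj₂ (Data.Product.Properties.,-injective eq))
    (compositions-unique (n ∸ i0))) _))
  (APP.map⁺ {f = bcompsWithHead n} (AP.map (λ i≢j {v} → disjoint i≢j {v}) (UP.applyUpTo⁺₁ id (suc n) (λ i<j _ → ℕP.<⇒≢ i<j))))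
  where
  disjoint : ∀ {i j} → i ≢ j → Disjoint (bcompsWithHead n i) (bcompsWithHead n j)
  disjoint {i} {j} i≢j (p , q) with ∈-map⁻ (i ,_) p | ∈-map⁻ (j ,_) q
  ... | c , _ , refl | c' , _ , eq = i≢j (cong proj₁ eq)

-- S_n in the Λ basis

SΛ : ℕ → SymT
SΛ j = sumOver (compositions j) (λ K → term (j ℕ.+ length K) 0 K)

Λ-suc-expansion : ∀ k → Λ (suc k) ≋ sumBelow (suc k) (λ i → scale (sgn i) (S (suc i) *S Λ (k ∸ i)))
Λ-suc-expansion k = begin
  Λ (suc k)                                                                     ≡⟨ map≡sumOver _ (compositions (suc k)) ⟩
  sumOver (compositions (suc k)) Λterm                                          ≈⟨ sumOver-compositions-suc k Λterm ⟩
  sumBelow (suc k) (λ i → sumOver (compositions (k ∸ i)) (λ c → Λterm (suc i ∷ c)))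
    ≈⟨ sumBelow-cong< (suc k) (λ i i≤k → sumOver-cong∈ (compositions (k ∸ i)) (λ c c∈ →
         ≡⇒≋ (cong (λ z → (z , 0 , suc i ∷ c) ∷ []) (sgn-∸-split (ℕP.≤-pred i≤k) (length≤ {i} c∈))))) ⟩
  sumBelow (suc k) (λ i → sumOver (compositions (k ∸ i)) (λ c → prefixTerm i (Λterm' i c) ∷ []))
    ≈⟨ sumBelow-cong (suc k) (λ i → ≡⇒≋ (sym (trans (scale-S-*S i (Λ (k ∸ i)))
         (trans (sym (LP.map-∘ (compositions (k ∸ i)))) (map≡sumOver _ (compositions (k ∸ i))))))) ⟩
  sumBelow (suc k) (λ i → scale (sgn i) (S (suc i) *S Λ (k ∸ i))) ∎
  where
  open ≋-Reasoning
  Λterm : List ℕ → SymT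
  Λterm K = (sgn (suc k ∸ length K) , 0 , K) ∷ []
  Λterm' : ℕ → List ℕ → Term
  Λterm' i c = (sgn ((k ∸ i) ∸ length c) , 0 , c)
  length≤ : ∀ {i c} → c ∈ compositions (k ∸ i) → length c ≤ k ∸ i
  length≤ {i} {c} c∈ = let (pos , sum≡) = compositions-sound (k ∸ i) c∈ in subst (length c ≤_) sum≡ (length≤sum pos)
  prefixTerm : ℕ → Term → Term
  prefixTerm i (q , b , v) = (sgn i ℚ.* q , b , suc i ∷ v)
  scale-S-*S : ∀ i y → scale (sgn i) (S (suc i) *S y) ≡ map (prefixTerm i) y
  scale-S-*S i y = trans (cong (scale (sgn i)) (LP.++-identityʳ (map (mulTerm (1ℚ , 0 , suc i ∷ [])) y)))
    (trans (sym (LP.map-∘ y)) (LP.map-cong (λ { (q , b , v) → cong (λ z → (sgn i ℚ.* z , b , suc i ∷ v)) (ℚP.*-identityˡ q) }) y))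

SΛ-suc-expansion : ∀ k → SΛ (suc k) ≋ sumBelow (suc k) (λ i → scale (sgn i) (Λ (suc i) *S SΛ (k ∸ i)))
SΛ-suc-expansion k = begin
  SΛ (suc k) ≈⟨ sumOver-compositions-suc k (λ K → term (suc k ℕ.+ length K) 0 K) ⟩
  sumBelow (suc k) (λ i → sumOver (compositions (k ∸ i)) (λ c → term (suc k ℕ.+ suc (length c)) 0 (suc i ∷ c)))
    ≈⟨ sumBelow-cong< (suc k) (λ i i≤k → sumOver-cong (compositions (k ∸ i)) (λ c → ≡⇒≋ (sym (sumOver-compositions-+ i c (ℕP.≤-pred i≤k))))) ⟩
  sumBelow (suc k) (λ i → sumOver (compositions (k ∸ i)) (λ c → scale (sgn i) (Λ (suc i) *S term ((k ∸ i) ℕ.+ length c) 0 c)))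
    ≈⟨ sumBelow-cong (suc k) (λ i → ≋-sym (≋-trans
         (scale-cong (sgn i) (sumOver-*ˡ (compositions (k ∸ i)) (λ c → term ((k ∸ i) ℕ.+ length c) 0 c) (Λ (suc i))))
         (≡⇒≋ (scale-sumOver (sgn i) (compositions (k ∸ i)) (λ c → Λ (suc i) *S term ((k ∸ i) ℕ.+ length c) 0 c))))) ⟩
  sumBelow (suc k) (λ i → scale (sgn i) (Λ (suc i) *S SΛ (k ∸ i))) ∎
  where
  open ≋-Reasoning
  sumOver-compositions-+ : ∀ i c → i ≤ k → scale (sgn i) (Λ (suc i) *S term ((k ∸ i) ℕ.+ length c) 0 c) ≡ term (suc k ℕ.+ suc (length c)) 0 (suc i ∷ c)
  sumOver-compositions-+ i c i≤k = trans (cong (scale (sgn i)) (Λ-*S-term (suc i) ((k ∸ i) ℕ.+ length c) 0 c))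
    (trans (scale-sgn-term i ((k ∸ i) ℕ.+ length c) 0 (suc i ∷ c))
    (term-sgn-cong (i ℕ.+ ((k ∸ i) ℕ.+ length c)) (suc k ℕ.+ suc (length c)) 0 (suc i ∷ c)
      (trans (cong sgn exponent≡) (sym (trans (cong sgn (shift k (length c))) (sgn-+-double (k ℕ.+ length c) 1))))))
    where
    exponent≡ : i ℕ.+ ((k ∸ i) ℕ.+ length c) ℕ.+ 0 ≡ k ℕ.+ length c
    exponent≡ = trans (ℕP.+-identityʳ _)
      (trans (sym (ℕP.+-assoc i (k ∸ i) (length c))) (cong (ℕ._+ length c) (ℕP.m+[n∸m]≡n i≤k)))
    shift : ∀ k l → suc k ℕ.+ suc l ℕ.+ 0 ≡ (k ℕ.+ l) ℕ.+ (1 ℕ.+ 1)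
    shift = solve-∀

-- 1 for j = 0 and 0 otherwise, once S is known to agree with SΛ up to degree j.
alternatingΛS : ℕ → SymT
alternatingΛS j = sumBelow (suc j) (λ q → scale (sgn q) (Λ q *S S (j ∸ q)))

alternatingΛ₊S : ℕ → SymT
alternatingΛ₊S k = sumBelow (suc k) (λ i → scale (sgn i) (Λ (suc i) *S S (k ∸ i)))

alternatingCell : ℕ → ℕ → ℕ → SymT
alternatingCell k p q = S (suc p) *S scale (sgn q) (Λ q *S S ((k ∸ p) ∸ q))

alternatingCell-reindex : ∀ k i p → p ≤ i →
  scale (sgn i) (scale (sgn p) (S (suc p) *S Λ (i ∸ p)) *S S (k ∸ i)) ≡ alternatingCell k p (i ∸ p)
alternatingCell-reindex k i p p≤i = begin
  scale (sgn i) (scale (sgn p) (Sp *S Λq) *S Sr)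
    ≡⟨ trans (scale≡tMonomial-*S (sgn i) _) (cong (λ z → tMonomial (sgn i) 0 *S (z *S Sr)) (scale≡tMonomial-*S (sgn p) (Sp *S Λq))) ⟩
  tMonomial (sgn i) 0 *S ((tMonomial (sgn p) 0 *S (Sp *S Λq)) *S Sr)
    ≡⟨ cong (tMonomial (sgn i) 0 *S_) (trans (*S-assoc (tMonomial (sgn p) 0) (Sp *S Λq) Sr) (cong (tMonomial (sgn p) 0 *S_) (*S-assoc Sp Λq Sr))) ⟩
  tMonomial (sgn i) 0 *S (tMonomial (sgn p) 0 *S (Sp *S (Λq *S Sr)))
    ≡⟨ sym (*S-assoc (tMonomial (sgn i) 0) (tMonomial (sgn p) 0) _) ⟩
  tMonomial (sgn i ℚ.* sgn p) 0 *S (Sp *S (Λq *S Sr))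
    ≡⟨ cong₂ (λ z r → tMonomial z 0 *S (Sp *S (Λq *S S r))) sgn≡ k∸i≡ ⟩
  tMonomial (sgn (i ∸ p)) 0 *S (Sp *S (Λq *S Sr'))
    ≡⟨ sym (*S-tMonomial-comm (sgn (i ∸ p)) 0 Sp (Λq *S Sr')) ⟩
  Sp *S (tMonomial (sgn (i ∸ p)) 0 *S (Λq *S Sr'))
    ≡⟨ cong (Sp *S_) (sym (scale≡tMonomial-*S (sgn (i ∸ p)) (Λq *S Sr'))) ⟩
  alternatingCell k p (i ∸ p) ∎
  where
  open ≡-Reasoning
  Sp  = S (suc p)
  Λq  = Λ (i ∸ p)
  Sr  = S (k ∸ i)
  Sr' = S ((k ∸ p) ∸ (i ∸ p))
  p+[i∸p]≡i : p ℕ.+ (i ∸ p) ≡ i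
  p+[i∸p]≡i = ℕP.m+[n∸m]≡n p≤i
  swap : ∀ p q → (p ℕ.+ q) ℕ.+ p ≡ q ℕ.+ (p ℕ.+ p)
  swap = solve-∀
  sgn≡ : sgn i ℚ.* sgn p ≡ sgn (i ∸ p)
  sgn≡ = trans (sym (sgn-+ i p)) (trans (cong (λ z → sgn (z ℕ.+ p)) (sym p+[i∸p]≡i))
    (trans (cong sgn (swap p (i ∸ p))) (sgn-+-double (i ∸ p) p)))
  k∸i≡ : k ∸ i ≡ (k ∸ p) ∸ (i ∸ p)
  k∸i≡ = trans (cong (k ∸_) (sym p+[i∸p]≡i)) (sym (ℕP.∸-+-assoc k p (i ∸ p)))

-- Expanding each Λ_(i+1) by Λ-suc-expansion and exchanging the two sums.
alternatingΛ₊S-regroup : ∀ k → alternatingΛ₊S k ≋ sumBelow (suc k) (λ p → S (suc p) *S alternatingΛS (k ∸ p))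
alternatingΛ₊S-regroup k = begin
  alternatingΛ₊S k
    ≈⟨ sumBelow-cong (suc k) (λ i → scale-cong (sgn i) (*S-cong (Λ-suc-expansion i) (≋-refl {S (k ∸ i)}))) ⟩
  sumBelow (suc k) (λ i → scale (sgn i) (sumBelow (suc i) (λ p → scale (sgn p) (S (suc p) *S Λ (i ∸ p))) *S S (k ∸ i)))
    ≈⟨ sumBelow-cong (suc k) (λ i → ≋-trans
         (≡⇒≋ (trans (cong (scale (sgn i)) (sumBelow-*ʳ (suc i) (λ p → scale (sgn p) (S (suc p) *S Λ (i ∸ p))) (S (k ∸ i))))
                     (scale-sumBelow (sgn i) (suc i) (λ p → scale (sgn p) (S (suc p) *S Λ (i ∸ p)) *S S (k ∸ i)))))
         (sumBelow-cong< (suc i) (λ p p≤i → ≡⇒≋ (alternatingCell-reindex k i p (ℕP.≤-pred p≤i))))) ⟩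
  sumBelow (suc k) (λ i → sumBelow (suc i) (λ p → alternatingCell k p (i ∸ p)))  ≈⟨ sumBelow-triangle k (alternatingCell k) ⟩
  sumBelow (suc k) (λ p → sumBelow (suc (k ∸ p)) (alternatingCell k p))
    ≈⟨ sumBelow-cong (suc k) (λ p → ≋-sym (sumBelow-*ˡ (suc (k ∸ p)) (λ q → scale (sgn q) (Λ q *S S ((k ∸ p) ∸ q))) (S (suc p)))) ⟩
  sumBelow (suc k) (λ p → S (suc p) *S alternatingΛS (k ∸ p)) ∎
  where
  open ≋-Reasoning

alternatingΛS-suc≋[] : ∀ k → (∀ l → l ≤ suc k → S l ≋ SΛ l) → alternatingΛS (suc k) ≋ []
alternatingΛS-suc≋[] k S≋SΛ = begin
  scale (sgn 0) (Λ 0 *S S (suc k)) ++ sumBelow (suc k) (λ q → scale (sgn (suc q)) (Λ (suc q) *S S (k ∸ q)))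
    ≈⟨ ++-cong (≋-trans (≡⇒≋ (trans (scale-identity (oneS *S S (suc k))) (*S-identityˡ (S (suc k))))) (S≋SΛ (suc k) ℕP.≤-refl))
               (sumBelow-cong< (suc k) (λ q q< → ≋-trans (≡⇒≋ (scale-sgn-suc q _))
                  (scale-cong (ℚ.- 1ℚ) (scale-cong (sgn q) (*S-congˡ (Λ (suc q))
                     (S≋SΛ (k ∸ q) (ℕP.≤-trans (ℕP.m∸n≤m k q) (ℕP.n≤1+n k)))))))) ⟩
  SΛ (suc k) ++ sumBelow (suc k) (λ q → neg (scale (sgn q) (Λ (suc q) *S SΛ (k ∸ q))))
    ≈⟨ ++-congˡ (SΛ (suc k)) (≡⇒≋ (sym (scale-sumBelow (ℚ.- 1ℚ) (suc k) (λ q → scale (sgn q) (Λ (suc q) *S SΛ (k ∸ q)))))) ⟩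
  SΛ (suc k) ++ neg (sumBelow (suc k) (λ q → scale (sgn q) (Λ (suc q) *S SΛ (k ∸ q))))
    ≈⟨ ++-congˡ (SΛ (suc k)) (scale-cong (ℚ.- 1ℚ) (≋-sym (SΛ-suc-expansion k))) ⟩
  SΛ (suc k) ++ neg (SΛ (suc k)) ≈⟨ ++-inverseʳ-≋ (SΛ (suc k)) ⟩
  [] ∎
  where open ≋-Reasoning

S≋SΛ-below : ∀ k l → l ≤ k → S l ≋ SΛ l
S≋SΛ-below zero    .zero z≤n = ≡⇒≋ refl
S≋SΛ-below (suc k) l l≤ with ℕP.m≤n⇒m<n∨m≡n l≤
... | inj₁ l<suck = S≋SΛ-below k l (ℕP.≤-pred l<suck)
... | inj₂ refl   = ≋-sym (begin
  SΛ (suc k) ≈⟨ SΛ-suc-expansion k ⟩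
  sumBelow (suc k) (λ i → scale (sgn i) (Λ (suc i) *S SΛ (k ∸ i)))
    ≈⟨ sumBelow-cong (suc k) (λ i → scale-cong (sgn i) (*S-congˡ (Λ (suc i)) (≋-sym (S≋SΛ-below k (k ∸ i) (ℕP.m∸n≤m k i))))) ⟩
  alternatingΛ₊S k ≈⟨ alternatingΛ₊S-regroup k ⟩
  sumBelow (suc k) (λ p → S (suc p) *S alternatingΛS (k ∸ p)) ≡⟨ sumBelow-suc-last k (λ p → S (suc p) *S alternatingΛS (k ∸ p)) ⟩
  sumBelow k (λ p → S (suc p) *S alternatingΛS (k ∸ p)) ++ S (suc k) *S alternatingΛS (k ∸ k)
    ≈⟨ ++-cong (sumBelow-≋[] k (λ p p<k → ≋-trans (*S-congˡ (S (suc p)) (vanishes p p<k)) (≡⇒≋ (*S-zeroʳ (S (suc p))))))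
               (≡⇒≋ (trans (cong (λ j → S (suc k) *S alternatingΛS j) (ℕP.n∸n≡0 k)) (*S-identityʳ (S (suc k))))) ⟩
  [] ++ S (suc k) ∎)
  where
  open ≋-Reasoning
  vanishes : ∀ p → p < k → alternatingΛS (k ∸ p) ≋ []
  vanishes p p<k rewrite ℕP.+-∸-assoc 1 p<k = alternatingΛS-suc≋[] (k ∸ suc p) (λ l' l'≤ →
    S≋SΛ-below k l' (ℕP.≤-trans l'≤ (subst (_≤ k) (ℕP.+-∸-assoc 1 p<k) (ℕP.m∸n≤m k p))))

S≋SΛ : ∀ l → S l ≋ SΛ l
S≋SΛ l = S≋SΛ-below l l ℕP.≤-refl

-- θ_t(S_m) in the Λ basis: Σ_{L ⊨ m} (-1)^(m - ℓ(L)) (1 - (-t)^(l₁)) Λ^L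

θΛ : ℕ → SymT
θΛ m = sumOver (compositions m) (λ L → term (m ℕ.+ length L) 0 L ++ term (m ℕ.+ length L ℕ.+ 1) (first L) L)

θS≋θΛ : ∀ m' → θS (suc m') ≋ θΛ (suc m')
θS≋θΛ m' = begin
  θS m                                   ≡⟨ trans (sumS-map≡sumOver (upTo (suc m)) θterm) (sym (sumBelow≡sumOver-upTo (suc m) θterm)) ⟩
  θterm 0 ++ sumBelow (suc m') (θterm ∘ suc)
    ≈⟨ ++-cong (≋-trans (≡⇒≋ (trans (tpow-zero _) (*S-identityˡ (S m)))) (S≋SΛ m))
               (sumBelow-cong< (suc m') (λ i i≤m' → θterm-suc i (ℕP.≤-pred i≤m'))) ⟩
  SΛ m ++ sumBelow (suc m') (λ i → sumOver (compositions (m' ∸ i)) (λ c → tPart (suc i ∷ c)))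
    ≈⟨ ++-congˡ (SΛ m) (≋-sym (sumOver-compositions-suc m' tPart)) ⟩
  SΛ m ++ sumOver (compositions m) tPart  ≈⟨ ≋-sym (sumOver-+ (compositions m) _ tPart) ⟩
  θΛ m                                   ∎
  where
  open ≋-Reasoning
  m = suc m'
  θterm : ℕ → SymT
  θterm k = tpow k (Λ k *S S (m ∸ k))
  tPart : List ℕ → SymT
  tPart L = term (m ℕ.+ length L ℕ.+ 1) (first L) L
  θterm-suc : ∀ i → i ≤ m' → θterm (suc i) ≋ sumOver (compositions (m' ∸ i)) (λ c → tPart (suc i ∷ c))
  θterm-suc i i≤m' = begin
    tpow (suc i) (Λ (suc i) *S S (m' ∸ i))  ≈⟨ tpow-cong (suc i) (*S-congˡ (Λ (suc i)) (S≋SΛ (m' ∸ i))) ⟩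
    tpow (suc i) (Λ (suc i) *S SΛ (m' ∸ i)) ≈⟨ tpow-cong (suc i) (sumOver-*ˡ (compositions (m' ∸ i)) _ (Λ (suc i))) ⟩
    tpow (suc i) (sumOver (compositions (m' ∸ i)) (λ c → Λ (suc i) *S term ((m' ∸ i) ℕ.+ length c) 0 c))
      ≡⟨ tpow-sumOver (suc i) (compositions (m' ∸ i)) _ ⟩
    sumOver (compositions (m' ∸ i)) (λ c → tpow (suc i) (Λ (suc i) *S term ((m' ∸ i) ℕ.+ length c) 0 c))
      ≈⟨ sumOver-cong (compositions (m' ∸ i)) (λ c → ≡⇒≋
           (trans (cong (tpow (suc i)) (Λ-*S-term (suc i) ((m' ∸ i) ℕ.+ length c) 0 c))
           (trans (tpow-term (suc i) ((m' ∸ i) ℕ.+ length c) 0 (suc i ∷ c) (m ℕ.+ suc (length c) ℕ.+ 1) (same-sign c))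
                  (cong (λ z → term (m ℕ.+ suc (length c) ℕ.+ 1) z (suc i ∷ c)) (ℕP.+-identityʳ (suc i)))))) ⟩
    sumOver (compositions (m' ∸ i)) (λ c → tPart (suc i ∷ c)) ∎
    where
    regroup : ∀ i d l → suc (i ℕ.+ d) ℕ.+ suc l ℕ.+ 1 ℕ.+ (suc i ℕ.+ 0) ≡ (d ℕ.+ l ℕ.+ 0) ℕ.+ ((i ℕ.+ 2) ℕ.+ (i ℕ.+ 2))
    regroup = solve-∀
    same-sign : ∀ c → sgn (m ℕ.+ suc (length c) ℕ.+ 1 ℕ.+ (suc i ℕ.+ 0)) ≡ sgn ((m' ∸ i) ℕ.+ length c ℕ.+ 0)
    same-sign c = trans (cong (λ z → sgn (suc z ℕ.+ suc (length c) ℕ.+ 1 ℕ.+ (suc i ℕ.+ 0))) (sym (ℕP.m+[n∸m]≡n i≤m')))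
      (trans (cong sgn (regroup i (m' ∸ i) (length c))) (sgn-+-double ((m' ∸ i) ℕ.+ length c ℕ.+ 0) (i ℕ.+ 2)))

≡ᵇ-refl : ∀ n → (n ≡ᵇ n) ≡ true
≡ᵇ-refl zero    = refl
≡ᵇ-refl (suc n) = ≡ᵇ-refl n

≡ᵇ-+-cancelˡ : ∀ a x y → ((a ℕ.+ x) ≡ᵇ (a ℕ.+ y)) ≡ (x ≡ᵇ y)
≡ᵇ-+-cancelˡ zero    x y = refl
≡ᵇ-+-cancelˡ (suc a) x y = ≡ᵇ-+-cancelˡ a x y

≢⇒≡ᵇ≡false : ∀ x y → x ≢ y → (x ≡ᵇ y) ≡ false
≢⇒≡ᵇ≡false x y x≢y with x ≡ᵇ y in eq
... | true  = ⊥-elim (x≢y (ℕP.≡ᵇ⇒≡ x y (subst T (sym eq) _)))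
... | false = refl

<⇒≡ᵇ≡false : ∀ x y → x < y → (x ≡ᵇ y) ≡ false
<⇒≡ᵇ≡false x y x<y = ≢⇒≡ᵇ≡false x y (ℕP.<⇒≢ x<y)

∨-≡false : ∀ a b → (a ∨ b) ≡ false → (a ≡ false) × (b ≡ false)
∨-≡false false false _ = refl , refl

memᵇ-++ : ∀ x D E → memᵇ x (D ++ E) ≡ (memᵇ x D ∨ memᵇ x E)
memᵇ-++ x []      E = refl
memᵇ-++ x (d ∷ D) E = trans (cong ((x ≡ᵇ d) ∨_) (memᵇ-++ x D E)) (sym (BP.∨-assoc (x ≡ᵇ d) (memᵇ x D) (memᵇ x E)))

memᵇ-snoc-self : ∀ c B → memᵇ c (B ++ c ∷ []) ≡ true
memᵇ-snoc-self c B = trans (memᵇ-++ c B (c ∷ []))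
  (trans (cong (λ b → memᵇ c B ∨ (b ∨ false)) (≡ᵇ-refl c)) (BP.∨-zeroʳ (memᵇ c B)))

memᵇ-snoc-≢ : ∀ x c B → x ≢ c → memᵇ x (B ++ c ∷ []) ≡ memᵇ x B
memᵇ-snoc-≢ x c B x≢c = trans (memᵇ-++ x B (c ∷ []))
  (trans (cong (λ b → memᵇ x B ∨ (b ∨ false)) (≢⇒≡ᵇ≡false x c x≢c)) (BP.∨-identityʳ (memᵇ x B)))

memᵇ-map-+ : ∀ a x l → memᵇ (a ℕ.+ x) (map (a ℕ.+_) l) ≡ memᵇ x l
memᵇ-map-+ a x []      = refl
memᵇ-map-+ a x (y ∷ l) = cong₂ _∨_ (≡ᵇ-+-cancelˡ a x y) (memᵇ-map-+ a x l)

memᵇ-All> : ∀ a E → All (ℕ._< a) E → memᵇ a E ≡ false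
memᵇ-All> a []      []       = refl
memᵇ-All> a (x ∷ E) (x<a ∷ ps) = cong₂ _∨_ (≢⇒≡ᵇ≡false a x (λ eq → ℕP.<⇒≢ x<a (sym eq))) (memᵇ-All> a E ps)

All<-weaken : ∀ {a b} E → a ≤ b → All (ℕ._< a) E → All (ℕ._< b) E
All<-weaken E a≤b = Allm.map (λ x<a → ℕP.<-≤-trans x<a a≤b)

startPositions : ℕ → List ℕ → List ℕ
startPositions a []       = []
startPositions a (j ∷ js) = a ∷ startPositions (a ℕ.+ j) js

startPositions-+ : ∀ a b c → startPositions (a ℕ.+ b) c ≡ map (a ℕ.+_) (startPositions b c)
startPositions-+ a b []       = refl
startPositions-+ a b (j ∷ js) =
  cong ((a ℕ.+ b) ∷_) (trans (cong (λ z → startPositions z js) (ℕP.+-assoc a b j)) (startPositions-+ a (b ℕ.+ j) js))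

memᵇ-startPositions-< : ∀ x a c → x < a → memᵇ x (startPositions a c) ≡ false
memᵇ-startPositions-< x a []       _   = refl
memᵇ-startPositions-< x a (j ∷ js) x<a =
  cong₂ _∨_ (<⇒≡ᵇ≡false x a x<a) (memᵇ-startPositions-< x (a ℕ.+ j) js (ℕP.<-≤-trans x<a (ℕP.m≤m+n a j)))

memᵇ-startPositions-suc : ∀ n' i c → i ≤ n' → memᵇ (suc n') (startPositions 0 (suc i ∷ c)) ≡ memᵇ (n' ∸ i) (startPositions 0 c)
memᵇ-startPositions-suc n' i c i≤n' = begin
  memᵇ (suc n') (startPositions (suc i) c)
    ≡⟨ cong (memᵇ (suc n')) (trans (cong (λ z → startPositions z c) (sym (ℕP.+-identityʳ (suc i)))) (startPositions-+ (suc i) 0 c)) ⟩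
  memᵇ (suc n') (map (suc i ℕ.+_) (startPositions 0 c))
    ≡⟨ cong (λ z → memᵇ (suc z) (map (suc i ℕ.+_) (startPositions 0 c))) (sym (ℕP.m+[n∸m]≡n i≤n')) ⟩
  memᵇ (suc i ℕ.+ (n' ∸ i)) (map (suc i ℕ.+_) (startPositions 0 c))
    ≡⟨ memᵇ-map-+ (suc i) (n' ∸ i) (startPositions 0 c) ⟩
  memᵇ (n' ∸ i) (startPositions 0 c) ∎
  where open ≡-Reasoning

sum∉startPositions : ∀ a K → All (1 ≤_) K → memᵇ (a ℕ.+ sumℕ K) (startPositions a K) ≡ false
sum∉startPositions a []      _        = refl
sum∉startPositions a (j ∷ K) (p ∷ ps) = cong₂ _∨_ (≢⇒≡ᵇ≡false _ _ beyond)
  (trans (cong (λ z → memᵇ z (startPositions (a ℕ.+ j) K)) (sym (ℕP.+-assoc a j (sumℕ K)))) (sum∉startPositions (a ℕ.+ j) K ps))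
  where
  beyond : a ℕ.+ (j ℕ.+ sumℕ K) ≢ a
  beyond eq = ℕP.<⇒≢ (ℕP.<-≤-trans (ℕP.m<m+n a p) (ℕP.+-monoʳ-≤ a (ℕP.m≤m+n j (sumℕ K)))) (sym eq)

startExponent : List ℕ → ℕ → List ℕ → ℕ
startExponent D a []       = 0
startExponent D a (j ∷ js) = (if memᵇ a D then j else 0) ℕ.+ startExponent D (a ℕ.+ j) js

startExponent-[] : ∀ a K → startExponent [] a K ≡ 0
startExponent-[] a []       = refl
startExponent-[] a (j ∷ js) = startExponent-[] (a ℕ.+ j) js

startExponent-0∷ : ∀ D a js → startExponent (0 ∷ D) (suc a) js ≡ startExponent D (suc a) js
startExponent-0∷ D a []       = refl
startExponent-0∷ D a (j ∷ js) = cong ((if memᵇ (suc a) D then j else 0) ℕ.+_) (startExponent-0∷ D (a ℕ.+ j) js)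

startExponent-++ : ∀ E a K L → startExponent E a (K ++ L) ≡ startExponent E a K ℕ.+ startExponent E (a ℕ.+ sumℕ K) L
startExponent-++ E a []      L = cong (λ z → startExponent E z L) (sym (ℕP.+-identityʳ a))
startExponent-++ E a (j ∷ K) L = trans (cong ((if memᵇ a E then j else 0) ℕ.+_)
  (trans (startExponent-++ E (a ℕ.+ j) K L) (cong (λ z → startExponent E (a ℕ.+ j) K ℕ.+ startExponent E z L) (ℕP.+-assoc a j (sumℕ K)))))
  (sym (ℕP.+-assoc (if memᵇ a E then j else 0) (startExponent E (a ℕ.+ j) K) _))

startExponent-beyond : ∀ E a L → All (ℕ._< a) E → startExponent E a L ≡ 0
startExponent-beyond E a []      _    = refl
startExponent-beyond E a (j ∷ L) E<a = cong₂ ℕ._+_ (cong (λ b → if b then j else 0) (memᵇ-All> a E E<a))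
  (startExponent-beyond E (a ℕ.+ j) L (All<-weaken E (ℕP.m≤m+n a j) E<a))

startExponent-snoc-∉ : ∀ D n a K → memᵇ n (startPositions a K) ≡ false → startExponent (D ++ n ∷ []) a K ≡ startExponent D a K
startExponent-snoc-∉ D n a []       _ = refl
startExponent-snoc-∉ D n a (j ∷ js) n∉ with ∨-≡false (n ≡ᵇ a) (memᵇ n (startPositions (a ℕ.+ j) js)) n∉
... | n≢a , n∉js = cong₂ ℕ._+_ (cong (λ b → if b then j else 0) (memᵇ-snoc-≢ a n D a≢n)) (startExponent-snoc-∉ D n (a ℕ.+ j) js n∉js)
  where
  a≢n : a ≢ n
  a≢n a≡n with trans (sym (≡ᵇ-refl n)) (subst (λ z → (n ≡ᵇ z) ≡ false) a≡n n≢a)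
  ... | ()

expA≡startExponent-Des : ∀ K a J → expA K a J ≡ startExponent (Des K) a J
expA≡startExponent-Des K a []       = refl
expA≡startExponent-Des K a (j ∷ js) = cong ((if memᵇ a (Des K) then j else 0) ℕ.+_) (expA≡startExponent-Des K (a ℕ.+ j) js)

0∉psums : ∀ a xs → All (1 ≤_) xs → memᵇ 0 (psums a xs) ≡ false
0∉psums a []           _        = refl
0∉psums a (x ∷ [])     _        = refl
0∉psums a (x ∷ y ∷ xs) (p ∷ ps) = cong₂ _∨_ (≢⇒≡ᵇ≡false 0 (a ℕ.+ x) (λ 0≡ → ℕP.<⇒≢ (ℕP.<-≤-trans p (ℕP.m≤n+m x a)) 0≡))
  (0∉psums (a ℕ.+ x) (y ∷ xs) ps)

-- The uniform form of both cases of the statement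

signedΛSum : ℕ → ℕ → List ℕ → SymT
signedΛSum n r D = sumOver (compositions n) (λ K → term (n ℕ.+ r ℕ.+ length K) (startExponent D 0 K) K)

formulaB : ℕ → BComp → SymT
formulaB n (j0 , J') = signedΛSum n (length J') (BDes (j0 , J'))

formulaB-trivial : ∀ n → formulaB n (n , []) ≋ S n
formulaB-trivial n = ≋-trans (sumOver-cong (compositions n) (λ K → ≡⇒≋
  (cong₂ (λ z y → term (z ℕ.+ length K) y K) (ℕP.+-identityʳ n) (startExponent-[] 0 K))))
  (≋-sym (S≋SΛ n))

-- The first part j₁ of the paper's i₀ = 0 case is the part starting at BDes's extra descent 0.
formula≋formulaB : ∀ n I → IsBComp n I → formula n I ≋ formulaB n I
formula≋formulaB n (zero , [])     (_ , refl) = ≡⇒≋ refl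
formula≋formulaB n (zero , x ∷ xs) (px ∷ pxs , _) = ≋-trans (≡⇒≋ (sumS-map≡sumOver (compositions n) _))
  (sumOver-cong∈ (compositions n) (λ K K∈ → ≡⇒≋
    (cong (λ z → term (n ℕ.+ length (x ∷ xs) ℕ.+ length K) z K) (exponent≡ K (proj₁ (compositions-sound n K∈))))))
  where
  exponent≡ : ∀ K → All (1 ≤_) K → first K ℕ.+ expA (x ∷ xs) 0 K ≡ startExponent (0 ∷ psums 0 (x ∷ xs)) 0 K
  exponent≡ []           _        = refl
  exponent≡ (zero ∷ js)  (() ∷ _)
  exponent≡ (suc j ∷ js) _        = cong (suc j ℕ.+_) (begin
      expA (x ∷ xs) 0 (suc j ∷ js)       ≡⟨ expA≡startExponent-Des (x ∷ xs) 0 (suc j ∷ js) ⟩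
      (if memᵇ 0 (Des (x ∷ xs)) then suc j else 0) ℕ.+ startExponent (Des (x ∷ xs)) (suc j) js
        ≡⟨ cong (λ b → (if b then suc j else 0) ℕ.+ startExponent (Des (x ∷ xs)) (suc j) js) (0∉psums 0 (x ∷ xs) (px ∷ pxs)) ⟩
      startExponent (Des (x ∷ xs)) (suc j) js ≡⟨ sym (startExponent-0∷ (Des (x ∷ xs)) j js) ⟩
      startExponent (0 ∷ psums 0 (x ∷ xs)) (suc j) js ∎)
    where open ≡-Reasoning
formula≋formulaB n (suc i , I') _ = ≋-trans (≡⇒≋ (sumS-map≡sumOver (compositions n) _))
  (sumOver-cong (compositions n) (λ K → ≡⇒≋ (trans
    (cong (λ z → term (n ℕ.+ 1 ℕ.+ length (suc i ∷ I') ℕ.+ length K) z K)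
          (trans (expA≡startExponent-Des (suc i ∷ I') 0 K) (Des≡BDes I' K)))
    (term-sgn-cong (n ℕ.+ 1 ℕ.+ length (suc i ∷ I') ℕ.+ length K) (n ℕ.+ length I' ℕ.+ length K) (E K) K
      (trans (cong sgn (shift n (length I') (length K) (E K))) (sgn-+-double (n ℕ.+ length I' ℕ.+ length K ℕ.+ E K) 1))))))
  where
  E : List ℕ → ℕ
  E = startExponent (BDes (suc i , I')) 0
  Des≡BDes : ∀ I' K → startExponent (Des (suc i ∷ I')) 0 K ≡ startExponent (BDes (suc i , I')) 0 K
  Des≡BDes []       K = refl
  Des≡BDes (x ∷ xs) K = refl
  shift : ∀ n r l e → n ℕ.+ 1 ℕ.+ suc r ℕ.+ l ℕ.+ e ≡ (n ℕ.+ r ℕ.+ l ℕ.+ e) ℕ.+ (1 ℕ.+ 1)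
  shift = solve-∀

-- Multiplying by θ_t(S_m)

-- Splitting the compositions of n + m that pass through n; g must vanish on all the others.
sumOver-compositions-+ : ∀ n m' (g : List ℕ → SymT) → (∀ K → memᵇ n (startPositions 0 K) ≡ false → g K ≋ []) →
  sumOver (compositions (n ℕ.+ suc m')) g ≋ sumOver (compositions n) (λ K → sumOver (compositions (suc m')) (λ L → g (K ++ L)))
sumOver-compositions-+ n m' = go n n ℕP.≤-refl
  where
  go : ∀ fuel n → n ≤ fuel → (g : List ℕ → SymT) → (∀ K → memᵇ n (startPositions 0 K) ≡ false → g K ≋ []) →
    sumOver (compositions (n ℕ.+ suc m')) g ≋ sumOver (compositions n) (λ K → sumOver (compositions (suc m')) (λ L → g (K ++ L)))
  go fuel       zero     _            g _      = ≡⇒≋ (sym (LP.++-identityʳ _))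
  go (suc fuel) (suc n') (s≤s n'≤fuel) g vanish = begin
    sumOver (compositions (suc (n' ℕ.+ suc m'))) g              ≈⟨ sumOver-compositions-suc (n' ℕ.+ suc m') g ⟩
    sumBelow (suc n' ℕ.+ suc m') byFirst                        ≡⟨ sumBelow-+-split (suc n') (suc m') byFirst ⟩
    sumBelow (suc n') byFirst ++ sumBelow (suc m') (λ j → byFirst (suc n' ℕ.+ j))
      ≈⟨ ++-cong (sumBelow-cong< (suc n') (λ i i≤n' → recurse i (ℕP.≤-pred i≤n'))) (sumBelow-≋[] (suc m') (λ j _ → skips j)) ⟩
    sumBelow (suc n') (λ i → sumOver (compositions (n' ∸ i)) (λ K → splitAtn (suc i ∷ K))) ++ []
      ≈⟨ ++-identityʳ-≋ ≋-refl ⟩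
    sumBelow (suc n') (λ i → sumOver (compositions (n' ∸ i)) (λ K → splitAtn (suc i ∷ K)))
      ≈⟨ ≋-sym (sumOver-compositions-suc n' splitAtn) ⟩
    sumOver (compositions (suc n')) splitAtn ∎
    where
    open ≋-Reasoning
    byFirst : ℕ → SymT
    byFirst i = sumOver (compositions ((n' ℕ.+ suc m') ∸ i)) (λ c → g (suc i ∷ c))
    splitAtn : List ℕ → SymT
    splitAtn K = sumOver (compositions (suc m')) (λ L → g (K ++ L))
    skips : ∀ j → byFirst (suc n' ℕ.+ j) ≋ []
    skips j = sumOver-≋[] (compositions ((n' ℕ.+ suc m') ∸ (suc n' ℕ.+ j))) (λ c → vanish (suc (suc n' ℕ.+ j) ∷ c)
      (memᵇ-startPositions-< (suc n') (suc (suc n' ℕ.+ j)) c (s≤s (ℕP.m≤m+n (suc n') j))))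
    recurse : ∀ i → i ≤ n' → byFirst i ≋ sumOver (compositions (n' ∸ i)) (λ K → splitAtn (suc i ∷ K))
    recurse i i≤n' = ≋-trans (≡⇒≋ (cong (λ z → sumOver (compositions z) (λ c → g (suc i ∷ c))) (ℕP.+-∸-comm (suc m') i≤n')))
      (go fuel (n' ∸ i) (ℕP.≤-trans (ℕP.m∸n≤m n' i) n'≤fuel) (λ c → g (suc i ∷ c))
        (λ c n∉ → vanish (suc i ∷ c) (trans (memᵇ-startPositions-suc n' i c i≤n') n∉)))

signedΛSum-*S-θΛ : ∀ n m' r D → All (ℕ._< n) D →
  signedΛSum n r D *S θΛ (suc m') ≋ signedΛSum (n ℕ.+ suc m') (r ℕ.+ 1) (D ++ n ∷ []) ++ signedΛSum (n ℕ.+ suc m') r D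
signedΛSum-*S-θΛ n m' r D D<n = begin
  signedΛSum n r D *S θΛ m                                   ≡⟨ sumOver-*ʳ (compositions n) left (θΛ m) ⟩
  sumOver (compositions n) (λ K → left K *S θΛ m)
    ≈⟨ sumOver-cong (compositions n) (λ K → sumOver-*ˡ (compositions m) (λ L → plain L ++ withT L) (left K)) ⟩
  sumOver (compositions n) (λ K → sumOver (compositions m) (λ L → left K *S (plain L ++ withT L)))
    ≈⟨ sumOver-cong∈ (compositions n) (λ K K∈ → sumOver-cong∈ (compositions m) (λ L L∈ →
         ≋-sym (product K L (compositions-sound n K∈) (compositions-sound m L∈)))) ⟩
  sumOver (compositions n) (λ K → sumOver (compositions m) (λ L → both (K ++ L)))
    ≈⟨ ≋-sym (sumOver-compositions-+ n m' both cancel) ⟩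
  sumOver (compositions N) both
    ≈⟨ sumOver-+ (compositions N) (λ K → term (N ℕ.+ (r ℕ.+ 1) ℕ.+ length K) (startExponent (D ++ n ∷ []) 0 K) K)
                                  (λ K → term (N ℕ.+ r ℕ.+ length K) (startExponent D 0 K) K) ⟩
  signedΛSum N (r ℕ.+ 1) (D ++ n ∷ []) ++ signedΛSum N r D ∎
  where
  open ≋-Reasoning
  m = suc m'
  N = n ℕ.+ m
  E : List ℕ → ℕ
  E = startExponent D 0
  left : List ℕ → SymT
  left K = term (n ℕ.+ r ℕ.+ length K) (E K) K
  plain withT : List ℕ → SymT
  plain L = term (m ℕ.+ length L) 0 L
  withT L = term (m ℕ.+ length L ℕ.+ 1) (first L) L
  both : List ℕ → SymT
  both K = term (N ℕ.+ (r ℕ.+ 1) ℕ.+ length K) (startExponent (D ++ n ∷ []) 0 K) K ++ term (N ℕ.+ r ℕ.+ length K) (E K) K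
  regroup₁ : ∀ N r l → N ℕ.+ (r ℕ.+ 1) ℕ.+ l ≡ suc (N ℕ.+ r ℕ.+ l)
  regroup₁ = solve-∀
  cancel : ∀ K → memᵇ n (startPositions 0 K) ≡ false → both K ≋ []
  cancel K n∉ = ≋-trans (≡⇒≋ (cong₂ (λ s e → term s e K ++ term (N ℕ.+ r ℕ.+ length K) (E K) K)
    (regroup₁ N r (length K)) (startExponent-snoc-∉ D n 0 K n∉))) (term-suc-cancel (N ℕ.+ r ℕ.+ length K) (E K) K)
  product : ∀ K L → IsComposition n K → IsComposition m L → both (K ++ L) ≋ left K *S (plain L ++ withT L)
  product K []       _           (_ , ())
  product K (l ∷ L') (Kpos , Ksum) (0<l ∷ _ , _) = begin
    both (K ++ L)
      ≡⟨ cong₂ _++_ (cong₂ (λ s e → term s e (K ++ L)) sign-new exponent-new) (cong₂ (λ s e → term s e (K ++ L)) sign-old exponent-old) ⟩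
    new ++ old ≈⟨ ++-comm-≋ new old ⟩
    old ++ new
      ≡⟨ sym (cong₂ _++_ (term-*S (n ℕ.+ r ℕ.+ length K) (E K) K (m ℕ.+ length L) 0 L)
                         (term-*S (n ℕ.+ r ℕ.+ length K) (E K) K (m ℕ.+ length L ℕ.+ 1) l L)) ⟩
    left K *S plain L ++ left K *S withT L                   ≈⟨ ≋-sym (*S-distribˡ (left K) (plain L) (withT L)) ⟩
    left K *S (plain L ++ withT L)                           ∎
    where
    L = l ∷ L'
    old = term (n ℕ.+ r ℕ.+ length K ℕ.+ (m ℕ.+ length L)) (E K ℕ.+ 0) (K ++ L)
    new = term (n ℕ.+ r ℕ.+ length K ℕ.+ (m ℕ.+ length L ℕ.+ 1)) (E K ℕ.+ l) (K ++ L)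
    regroup₂ : ∀ n m r a b → n ℕ.+ m ℕ.+ r ℕ.+ (a ℕ.+ b) ≡ n ℕ.+ r ℕ.+ a ℕ.+ (m ℕ.+ b)
    regroup₂ = solve-∀
    regroup₃ : ∀ n m r a b → n ℕ.+ m ℕ.+ (r ℕ.+ 1) ℕ.+ (a ℕ.+ b) ≡ n ℕ.+ r ℕ.+ a ℕ.+ (m ℕ.+ b ℕ.+ 1)
    regroup₃ = solve-∀
    sign-old : N ℕ.+ r ℕ.+ length (K ++ L) ≡ n ℕ.+ r ℕ.+ length K ℕ.+ (m ℕ.+ length L)
    sign-old = trans (cong (N ℕ.+ r ℕ.+_) (LP.length-++ K)) (regroup₂ n m r (length K) (length L))
    sign-new : N ℕ.+ (r ℕ.+ 1) ℕ.+ length (K ++ L) ≡ n ℕ.+ r ℕ.+ length K ℕ.+ (m ℕ.+ length L ℕ.+ 1)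
    sign-new = trans (cong (N ℕ.+ (r ℕ.+ 1) ℕ.+_) (LP.length-++ K)) (regroup₃ n m r (length K) (length L))
    exponent-old : startExponent D 0 (K ++ L) ≡ E K ℕ.+ 0
    exponent-old = trans (startExponent-++ D 0 K L)
      (cong (E K ℕ.+_) (startExponent-beyond D (0 ℕ.+ sumℕ K) L (subst (λ b → All (ℕ._< b) D) (sym Ksum) D<n)))
    exponent-new : startExponent (D ++ n ∷ []) 0 (K ++ L) ≡ E K ℕ.+ l
    exponent-new = trans (startExponent-++ (D ++ n ∷ []) 0 K L) (cong₂ ℕ._+_
      (startExponent-snoc-∉ D n 0 K (subst (λ b → memᵇ b (startPositions 0 K) ≡ false) Ksum (sum∉startPositions 0 K Kpos)))
      (trans (cong (λ b → startExponent (D ++ n ∷ []) b L) Ksum)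
        (trans (cong₂ ℕ._+_ (cong (λ b → if b then l else 0) (memᵇ-snoc-self n D))
                            (startExponent-beyond (D ++ n ∷ []) (n ℕ.+ l) L'
                              (AllP.++⁺ (All<-weaken D (ℕP.m≤m+n n l) D<n) (ℕP.m<m+n n 0<l ∷ []))))
               (ℕP.+-identityʳ l))))

-- Type-B compositions: a new last part, or a larger last part

snocPart : ℕ → BComp → BComp
snocPart m (j0 , J') = (j0 , J' ++ m ∷ [])

growLast : ℕ → ℕ → List ℕ → List ℕ
growLast m x []       = (x ℕ.+ m) ∷ []
growLast m x (y ∷ ys) = x ∷ growLast m y ys

-- With no parts the increment goes to i₀.
growLastPart : ℕ → BComp → BComp
growLastPart m (j0 , [])     = (j0 ℕ.+ m , [])
growLastPart m (j0 , x ∷ xs) = (j0 , growLast m x xs)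

psums-snoc : ∀ a x xs m → psums a ((x ∷ xs) ++ m ∷ []) ≡ psums a (x ∷ xs) ++ (a ℕ.+ sumℕ (x ∷ xs)) ∷ []
psums-snoc a x []       m = cong (λ z → z ∷ []) (cong (a ℕ.+_) (sym (ℕP.+-identityʳ x)))
psums-snoc a x (y ∷ ys) m = cong ((a ℕ.+ x) ∷_) (trans (psums-snoc (a ℕ.+ x) y ys m)
  (cong (λ z → psums (a ℕ.+ x) (y ∷ ys) ++ z ∷ []) (ℕP.+-assoc a x (sumℕ (y ∷ ys)))))

BDes-snocPart : ∀ m j0 J' → BDes (snocPart m (j0 , J')) ≡ BDes (j0 , J') ++ (j0 ℕ.+ sumℕ J') ∷ []
BDes-snocPart m j0 []       = cong (λ z → z ∷ []) (sym (ℕP.+-identityʳ j0))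
BDes-snocPart m j0 (x ∷ xs) = cong (j0 ∷_) (psums-snoc j0 x xs m)

psums-growLast : ∀ a m x xs → psums a (growLast m x xs) ≡ psums a (x ∷ xs)
psums-growLast a m x []           = refl
psums-growLast a m x (y ∷ [])     = refl
psums-growLast a m x (y ∷ z ∷ zs) = cong ((a ℕ.+ x) ∷_) (psums-growLast (a ℕ.+ x) m y (z ∷ zs))

BDes-growLastPart : ∀ m J → BDes (growLastPart m J) ≡ BDes J
BDes-growLastPart m (j0 , [])         = refl
BDes-growLastPart m (j0 , x ∷ [])     = refl
BDes-growLastPart m (j0 , x ∷ y ∷ ys) = cong (j0 ∷_) (psums-growLast j0 m x (y ∷ ys))

length-growLastPart : ∀ m J → length (proj₂ (growLastPart m J)) ≡ length (proj₂ J)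
length-growLastPart m (j0 , [])     = refl
length-growLastPart m (j0 , x ∷ xs) = length-growLast x xs
  where
  length-growLast : ∀ x xs → length (growLast m x xs) ≡ length (x ∷ xs)
  length-growLast x []       = refl
  length-growLast x (y ∷ ys) = cong suc (length-growLast y ys)

growLastPart-snocPart : ∀ m j0 ys d → growLastPart m (snocPart d (j0 , ys)) ≡ snocPart (d ℕ.+ m) (j0 , ys)
growLastPart-snocPart m j0 []       d = refl
growLastPart-snocPart m j0 (y ∷ ys) d = cong (j0 ,_) (growLast-snoc y ys)
  where
  growLast-snoc : ∀ y zs → growLast m y (zs ++ d ∷ []) ≡ (y ∷ zs) ++ (d ℕ.+ m) ∷ []
  growLast-snoc y []       = refl
  growLast-snoc y (z ∷ zs) = cong (y ∷_) (growLast-snoc z zs)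

BDes-< : ∀ n J → IsBComp n J → All (ℕ._< n) (BDes J)
BDes-< n (j0 , [])     _           = []
BDes-< n (j0 , x ∷ xs) (pos , sum≡) = subst (λ b → All (ℕ._< b) (BDes (j0 , x ∷ xs))) sum≡ (psums-< j0 x xs pos)
  where
  psums-< : ∀ a x xs → All (1 ≤_) (x ∷ xs) → All (ℕ._< a ℕ.+ sumℕ (x ∷ xs)) (a ∷ psums a (x ∷ xs))
  psums-< a x []       (p ∷ _)  = ℕP.<-≤-trans (ℕP.m<m+n a p) (ℕP.≤-reflexive (cong (a ℕ.+_) (sym (ℕP.+-identityʳ x)))) ∷ []
  psums-< a x (y ∷ ys) (p ∷ ps) = ℕP.<-≤-trans (ℕP.m<m+n a p) (ℕP.+-monoʳ-≤ a (ℕP.m≤m+n x _)) ∷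
    subst (λ b → All (ℕ._< b) ((a ℕ.+ x) ∷ psums (a ℕ.+ x) (y ∷ ys))) (ℕP.+-assoc a x (sumℕ (y ∷ ys))) (psums-< (a ℕ.+ x) y ys ps)

IsBComp-snocPart : ∀ n m J → 1 ≤ m → IsBComp n J → IsBComp (n ℕ.+ m) (snocPart m J)
IsBComp-snocPart n m (j0 , J') 0<m (pos , sum≡) = AllP.++⁺ pos (0<m ∷ []) ,
  trans (cong (j0 ℕ.+_) (ListActionP.sum-++ J' (m ∷ []))) (trans (regroup j0 (sumℕ J') m) (cong (ℕ._+ m) sum≡))
  where
  regroup : ∀ j0 s m → j0 ℕ.+ (s ℕ.+ (m ℕ.+ 0)) ≡ (j0 ℕ.+ s) ℕ.+ m
  regroup = solve-∀

IsBComp-growLastPart : ∀ n m J → IsBComp n J → IsBComp (n ℕ.+ m) (growLastPart m J)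
IsBComp-growLastPart n m (j0 , [])     ([] , sum≡) =
  [] , trans (ℕP.+-identityʳ (j0 ℕ.+ m)) (cong (ℕ._+ m) (trans (sym (ℕP.+-identityʳ j0)) sum≡))
IsBComp-growLastPart n m (j0 , x ∷ xs) (pos , sum≡) = growLast-positive x xs pos ,
  trans (cong (j0 ℕ.+_) (sum-growLast x xs)) (trans (sym (ℕP.+-assoc j0 _ m)) (cong (ℕ._+ m) sum≡))
  where
  growLast-positive : ∀ x xs → All (1 ≤_) (x ∷ xs) → All (1 ≤_) (growLast m x xs)
  growLast-positive x []       (p ∷ _)  = ℕP.≤-trans p (ℕP.m≤m+n x m) ∷ []
  growLast-positive x (y ∷ ys) (p ∷ ps) = p ∷ growLast-positive y ys ps
  sum-growLast : ∀ x xs → sumℕ (growLast m x xs) ≡ sumℕ (x ∷ xs) ℕ.+ m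
  sum-growLast x []       = trans (ℕP.+-identityʳ (x ℕ.+ m)) (cong (ℕ._+ m) (sym (ℕP.+-identityʳ x)))
  sum-growLast x (y ∷ ys) = trans (cong (x ℕ.+_) (sum-growLast y ys)) (sym (ℕP.+-assoc x (sumℕ (y ∷ ys)) m))

IsBComp-unsnoc : ∀ n i0 xs m → IsBComp n (i0 , xs ++ m ∷ []) →
  IsBComp (i0 ℕ.+ sumℕ xs) (i0 , xs) × 1 ≤ m × n ≡ (i0 ℕ.+ sumℕ xs) ℕ.+ m
IsBComp-unsnoc n i0 xs m (pos , sum≡) with AllP.++⁻ xs pos
... | (pos-xs , 0<m ∷ []) = (pos-xs , refl) , 0<m , trans (sym sum≡) (trans (cong (i0 ℕ.+_) (ListActionP.sum-++ xs (m ∷ []))) (regroup i0 (sumℕ xs) m))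
  where
  regroup : ∀ j0 s m → j0 ℕ.+ (s ℕ.+ (m ℕ.+ 0)) ≡ (j0 ℕ.+ s) ℕ.+ m
  regroup = solve-∀

snocPart-injective : ∀ m {J₁ J₂} → snocPart m J₁ ≡ snocPart m J₂ → J₁ ≡ J₂
snocPart-injective m {j1 , A} {j2 , B} eq = cong₂ _,_ (cong proj₁ eq) (proj₁ (LP.∷ʳ-injective A B (cong proj₂ eq)))

growLast≢[] : ∀ m x xs → growLast m x xs ≢ []
growLast≢[] m x []       ()
growLast≢[] m x (y ∷ ys) ()

growLastPart-injective : ∀ m {J₁ J₂} → growLastPart m J₁ ≡ growLastPart m J₂ → J₁ ≡ J₂
growLastPart-injective m {j1 , []}     {j2 , []}       eq = cong (_, []) (ℕP.+-cancelʳ-≡ m j1 j2 (cong proj₁ eq))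
growLastPart-injective m {j1 , []}     {j2 , x ∷ xs}   eq = ⊥-elim (growLast≢[] m x xs (sym (cong proj₂ eq)))
growLastPart-injective m {j1 , x ∷ xs} {j2 , []}       eq = ⊥-elim (growLast≢[] m x xs (cong proj₂ eq))
growLastPart-injective m {j1 , x ∷ xs} {j2 , x' ∷ xs'} eq = cong₂ _,_ (cong proj₁ eq) (growLast-injective x xs x' xs' (cong proj₂ eq))
  where
  growLast-injective : ∀ x xs x' xs' → growLast m x xs ≡ growLast m x' xs' → x ∷ xs ≡ x' ∷ xs'
  growLast-injective x []       x' []         eq = cong (_∷ []) (ℕP.+-cancelʳ-≡ m x x' (proj₁ (LP.∷-injective eq)))
  growLast-injective x []       x' (y' ∷ ys') eq = ⊥-elim (growLast≢[] m y' ys' (sym (proj₂ (LP.∷-injective eq))))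
  growLast-injective x (y ∷ ys) x' []         eq = ⊥-elim (growLast≢[] m y ys (proj₂ (LP.∷-injective eq)))
  growLast-injective x (y ∷ ys) x' (y' ∷ ys') eq =
    cong₂ _∷_ (proj₁ (LP.∷-injective eq)) (growLast-injective y ys y' ys' (proj₂ (LP.∷-injective eq)))

snoc≢[] : ∀ (A : List ℕ) m → A ++ m ∷ [] ≢ []
snoc≢[] A m eq with LP.++-conicalʳ A (m ∷ []) eq
... | ()

snocPart≢growLastPart : ∀ m J₁ J₂ → All (1 ≤_) (proj₂ J₂) → snocPart m J₁ ≢ growLastPart m J₂
snocPart≢growLastPart m (j1 , A) (j2 , [])     _   eq = snoc≢[] A m (cong proj₂ eq)
snocPart≢growLastPart m (j1 , A) (j2 , x ∷ xs) pos eq = snoc≢growLast A x xs pos (cong proj₂ eq)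
  where
  snoc≢growLast : ∀ (A : List ℕ) x xs → All (1 ≤_) (x ∷ xs) → A ++ m ∷ [] ≢ growLast m x xs
  snoc≢growLast []      zero    []       (() ∷ _) eq
  snoc≢growLast []      (suc x) []       _        eq with ℕP.+-cancelʳ-≡ m 0 (suc x) (proj₁ (LP.∷-injective eq))
  ... | ()
  snoc≢growLast (a ∷ A) x       []       _        eq = snoc≢[] A m (proj₂ (LP.∷-injective eq))
  snoc≢growLast []      x       (y ∷ ys) _        eq = growLast≢[] m y ys (sym (proj₂ (LP.∷-injective eq)))
  snoc≢growLast (a ∷ A) x       (y ∷ ys) (_ ∷ ps) eq = snoc≢growLast A y ys ps (proj₂ (LP.∷-injective eq))

infix 4 _⊆ᵐ_
_⊆ᵐ_ : List ℕ → List ℕ → Set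
A ⊆ᵐ B = All (λ x → memᵇ x B ≡ true) A

⊆ᵇ⇒⊆ᵐ : ∀ A B → T (A ⊆ᵇ B) → A ⊆ᵐ B
⊆ᵇ⇒⊆ᵐ []      B _ = []
⊆ᵇ⇒⊆ᵐ (x ∷ A) B t with memᵇ x B in x∈B
... | true  = x∈B ∷ ⊆ᵇ⇒⊆ᵐ A B t
... | false = ⊥-elim t

⊆ᵐ⇒⊆ᵇ : ∀ A B → A ⊆ᵐ B → T (A ⊆ᵇ B)
⊆ᵐ⇒⊆ᵇ []      B []         = _
⊆ᵐ⇒⊆ᵇ (x ∷ A) B (x∈B ∷ A⊆B) rewrite x∈B = ⊆ᵐ⇒⊆ᵇ A B A⊆B

⊆ᵐ-++ʳ : ∀ {A} B C → A ⊆ᵐ B → A ⊆ᵐ B ++ C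
⊆ᵐ-++ʳ B C = Allm.map (λ {x} x∈B → trans (memᵇ-++ x B C) (cong (_∨ memᵇ x C) x∈B))

⊆ᵐ-unsnoc : ∀ {A} B c → A ⊆ᵐ B ++ c ∷ [] → All (ℕ._< c) A → A ⊆ᵐ B
⊆ᵐ-unsnoc B c A⊆ A<c = Allm.zipWith (λ {x} (x∈ , x<c) → trans (sym (memᵇ-snoc-≢ x c B (ℕP.<⇒≢ x<c))) x∈) (A⊆ , A<c)

-- The type-B compositions J with BDes J ⊆ BDes (i₀ , reverse rs), built part by part from the last one.
coarsenings : ℕ → List ℕ → List BComp
coarsenings i0 []       = (i0 , []) ∷ []
coarsenings i0 (m ∷ rs) = map (snocPart m) (coarsenings i0 rs) ++ map (growLastPart m) (coarsenings i0 rs)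

IsBComp-reverse-∷ : ∀ n i0 rs m → IsBComp n (i0 , reverse (m ∷ rs)) →
  IsBComp (i0 ℕ.+ sumℕ (reverse rs)) (i0 , reverse rs) × 1 ≤ m × n ≡ (i0 ℕ.+ sumℕ (reverse rs)) ℕ.+ m
IsBComp-reverse-∷ n i0 rs m valid =
  IsBComp-unsnoc n i0 (reverse rs) m (subst (λ z → IsBComp n (i0 , z)) (LP.unfold-reverse m rs) valid)

BDes-reverse-∷ : ∀ i0 rs m → BDes (i0 , reverse (m ∷ rs)) ≡ BDes (i0 , reverse rs) ++ (i0 ℕ.+ sumℕ (reverse rs)) ∷ []
BDes-reverse-∷ i0 rs m = trans (cong (λ z → BDes (i0 , z)) (LP.unfold-reverse m rs)) (BDes-snocPart m i0 (reverse rs))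

module _ (i0 : ℕ) where

  coarsenings-IsBComp : ∀ rs n → IsBComp n (i0 , reverse rs) → ∀ J → J ∈ coarsenings i0 rs → IsBComp n J
  coarsenings-IsBComp []       n valid J (here refl) = valid
  coarsenings-IsBComp (m ∷ rs) n valid J J∈ with IsBComp-reverse-∷ n i0 rs m valid
  ... | valid₀ , 0<m , refl with ∈-++⁻ (map (snocPart m) (coarsenings i0 rs)) J∈
  ...   | inj₁ p with ∈-map⁻ (snocPart m) p
  ...     | J₀ , J₀∈ , refl = IsBComp-snocPart _ m J₀ 0<m (coarsenings-IsBComp rs _ valid₀ J₀ J₀∈)
  coarsenings-IsBComp (m ∷ rs) n valid J J∈ | valid₀ , 0<m , refl | inj₂ p with ∈-map⁻ (growLastPart m) p
  ...     | J₀ , J₀∈ , refl = IsBComp-growLastPart _ m J₀ (coarsenings-IsBComp rs _ valid₀ J₀ J₀∈)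

  coarsenings-⊆ : ∀ rs n → IsBComp n (i0 , reverse rs) → ∀ J → J ∈ coarsenings i0 rs → BDes J ⊆ᵐ BDes (i0 , reverse rs)
  coarsenings-⊆ []       n valid J (here refl) = []
  coarsenings-⊆ (m ∷ rs) n valid J J∈ with IsBComp-reverse-∷ n i0 rs m valid
  ... | valid₀ , _ , _ rewrite BDes-reverse-∷ i0 rs m with ∈-++⁻ (map (snocPart m) (coarsenings i0 rs)) J∈
  ...   | inj₁ p with ∈-map⁻ (snocPart m) p
  ...     | J₀@(j0 , J₀') , J₀∈ , refl rewrite BDes-snocPart m j0 J₀' | proj₂ (coarsenings-IsBComp rs _ valid₀ J₀ J₀∈) =
    AllP.++⁺ (⊆ᵐ-++ʳ (BDes (i0 , reverse rs)) (_ ∷ []) (coarsenings-⊆ rs _ valid₀ J₀ J₀∈)) (memᵇ-snoc-self _ (BDes (i0 , reverse rs)) ∷ [])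
  coarsenings-⊆ (m ∷ rs) n valid J J∈ | valid₀ , _ , _ | inj₂ p with ∈-map⁻ (growLastPart m) p
  ...     | J₀ , J₀∈ , refl rewrite BDes-growLastPart m J₀ = ⊆ᵐ-++ʳ (BDes (i0 , reverse rs)) (_ ∷ []) (coarsenings-⊆ rs _ valid₀ J₀ J₀∈)

  -- A J below the (extended) descent set either ends exactly at the new descent n₀ (then it is a snocPart),
  -- or its last part straddles n₀ (then it is a growLastPart); ending before n₀ would contradict BDes J ⊆ B₀ ∪ {n₀}.
  coarsenings-complete-snoc : ∀ (L : List BComp) n₀ B₀ m j0 ys x →
    (∀ J → IsBComp n₀ J → BDes J ⊆ᵐ B₀ → J ∈ L) → All (ℕ._< n₀) B₀ →
    IsBComp (n₀ ℕ.+ m) (j0 , ys ++ x ∷ []) → BDes (j0 , ys ++ x ∷ []) ⊆ᵐ B₀ ++ n₀ ∷ [] →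
    (j0 , ys ++ x ∷ []) ∈ map (snocPart m) L ++ map (growLastPart m) L
  coarsenings-complete-snoc L n₀ B₀ m j0 ys x complete B₀<n₀ valid ⊆B
    with IsBComp-unsnoc (n₀ ℕ.+ m) j0 ys x valid
  ... | valid-ys , 0<x , sum≡ with AllP.++⁻ (BDes (j0 , ys)) (subst (_⊆ᵐ B₀ ++ n₀ ∷ []) (BDes-snocPart x j0 ys) ⊆B)
  ...   | ys⊆ , (p∈ ∷ []) with ℕP.<-cmp x m
  ...     | tri< x<m _ _ = ⊥-elim (true≢false (trans (sym p∈) (memᵇ-All> p (B₀ ++ n₀ ∷ [])
            (AllP.++⁺ (All<-weaken B₀ (ℕP.<⇒≤ n₀<p) B₀<n₀) (n₀<p ∷ [])))))
    where
    p = j0 ℕ.+ sumℕ ys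
    n₀<p : n₀ < p
    n₀<p = ℕP.≰⇒> (λ p≤n₀ → ℕP.<-irrefl (sym sum≡) (ℕP.+-mono-≤-< p≤n₀ x<m))
    true≢false : true ≢ false
    true≢false ()
  ...     | tri≈ _ refl _ = ∈-++⁺ˡ (∈-map⁺ (snocPart m) (complete (j0 , ys) (subst (λ z → IsBComp z (j0 , ys)) p≡n₀ valid-ys)
            (⊆ᵐ-unsnoc B₀ n₀ ys⊆ (subst (λ z → All (ℕ._< z) (BDes (j0 , ys))) p≡n₀ (BDes-< _ (j0 , ys) valid-ys)))))
    where
    p≡n₀ : j0 ℕ.+ sumℕ ys ≡ n₀
    p≡n₀ = ℕP.+-cancelʳ-≡ m (j0 ℕ.+ sumℕ ys) n₀ (sym sum≡)
  ...     | tri> _ _ m<x = ∈-++⁺ʳ (map (snocPart m) L)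
            (subst (_∈ map (growLastPart m) L) grown (∈-map⁺ (growLastPart m) (complete K valid-K K⊆)))
    where
    p = j0 ℕ.+ sumℕ ys
    d = x ∸ m
    d+m≡x : d ℕ.+ m ≡ x
    d+m≡x = ℕP.m∸n+n≡m (ℕP.<⇒≤ m<x)
    0<d : 1 ≤ d
    0<d = ℕP.m<n⇒0<n∸m m<x
    p+d≡n₀ : p ℕ.+ d ≡ n₀
    p+d≡n₀ = ℕP.+-cancelʳ-≡ m (p ℕ.+ d) n₀ (trans (ℕP.+-assoc p d m) (trans (cong (p ℕ.+_) d+m≡x) (sym sum≡)))
    p<n₀ : p < n₀
    p<n₀ = subst (p <_) p+d≡n₀ (ℕP.m<m+n p 0<d)
    K = snocPart d (j0 , ys)
    valid-K : IsBComp n₀ K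
    valid-K = subst (λ z → IsBComp z K) p+d≡n₀ (IsBComp-snocPart p d (j0 , ys) 0<d valid-ys)
    K⊆ : BDes K ⊆ᵐ B₀
    K⊆ = subst (_⊆ᵐ B₀) (sym (BDes-snocPart d j0 ys))
      (⊆ᵐ-unsnoc B₀ n₀ (AllP.++⁺ ys⊆ (p∈ ∷ []))
        (AllP.++⁺ (All<-weaken (BDes (j0 , ys)) (ℕP.<⇒≤ p<n₀) (BDes-< p (j0 , ys) valid-ys)) (p<n₀ ∷ [])))
    grown : growLastPart m K ≡ (j0 , ys ++ x ∷ [])
    grown = trans (growLastPart-snocPart m j0 ys d) (cong (λ z → (j0 , ys ++ z ∷ [])) d+m≡x)

  coarsenings-complete : ∀ rs n → IsBComp n (i0 , reverse rs) →
    ∀ J → IsBComp n J → BDes J ⊆ᵐ BDes (i0 , reverse rs) → J ∈ coarsenings i0 rs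
  coarsenings-complete []       n (_ , sum≡) (j0 , [])     (_ , sum≡') _ =
    here (cong (_, []) (ℕP.+-cancelʳ-≡ 0 j0 i0 (trans sum≡' (sym sum≡))))
  coarsenings-complete []       n _          (j0 , x ∷ xs) _ (() ∷ _)
  coarsenings-complete (m ∷ rs) n valid (j0 , J') valid-J J⊆ with IsBComp-reverse-∷ n i0 rs m valid
  ... | valid₀ , _ , refl with initLast J'
  ...   | [] = ∈-++⁺ʳ (map (snocPart m) (coarsenings i0 rs)) (subst (_∈ map (growLastPart m) (coarsenings i0 rs)) grown
            (∈-map⁺ (growLastPart m) (coarsenings-complete rs n₀ valid₀ (n₀ , []) ([] , ℕP.+-identityʳ n₀) [])))
    where
    n₀ = i0 ℕ.+ sumℕ (reverse rs)
    grown : growLastPart m (n₀ , []) ≡ (j0 , [])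
    grown = cong (_, []) (trans (sym (proj₂ valid-J)) (ℕP.+-identityʳ j0))
  ...   | ys ∷ʳ′ x = coarsenings-complete-snoc (coarsenings i0 rs) _ (BDes (i0 , reverse rs)) m j0 ys x
            (coarsenings-complete rs _ valid₀) (BDes-< _ (i0 , reverse rs) valid₀) valid-J
            (subst (BDes (j0 , ys ++ x ∷ []) ⊆ᵐ_) (BDes-reverse-∷ i0 rs m) J⊆)

  coarsenings-unique : ∀ rs n → IsBComp n (i0 , reverse rs) → Unique (coarsenings i0 rs)
  coarsenings-unique []       n valid = [] ∷ []
  coarsenings-unique (m ∷ rs) n valid with IsBComp-reverse-∷ n i0 rs m valid
  ... | valid₀ , _ , _ = UP.++⁺ (UP.map⁺ (snocPart-injective m) (coarsenings-unique rs _ valid₀))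
                               (UP.map⁺ (growLastPart-injective m) (coarsenings-unique rs _ valid₀)) disjoint
    where
    disjoint : Disjoint (map (snocPart m) (coarsenings i0 rs)) (map (growLastPart m) (coarsenings i0 rs))
    disjoint (p , q) with ∈-map⁻ (snocPart m) p | ∈-map⁻ (growLastPart m) q
    ... | J₁ , _ , refl | J₂ , J₂∈ , eq = snocPart≢growLastPart m J₁ J₂ (proj₁ (coarsenings-IsBComp rs _ valid₀ J₂ J₂∈)) eq

  coarsenings-length : ∀ rs J → J ∈ coarsenings i0 rs → length (proj₂ J) ≤ length rs
  coarsenings-length []       J (here refl) = z≤n
  coarsenings-length (m ∷ rs) J J∈ with ∈-++⁻ (map (snocPart m) (coarsenings i0 rs)) J∈
  ... | inj₁ p with ∈-map⁻ (snocPart m) p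
  ...   | (j0 , J') , J₀∈ , refl = subst (_≤ suc (length rs)) (sym (trans (LP.length-++ J') (ℕP.+-comm (length J') 1)))
            (s≤s (coarsenings-length rs (j0 , J') J₀∈))
  coarsenings-length (m ∷ rs) J J∈ | inj₂ p with ∈-map⁻ (growLastPart m) p
  ...   | J₀ , J₀∈ , refl = ℕP.m≤n⇒m≤1+n (subst (_≤ length rs) (sym (length-growLastPart m J₀)) (coarsenings-length rs J₀ J₀∈))

  coarsenings-head : ∀ rs → Σ (List BComp) λ rest →
    (coarsenings i0 rs ≡ (i0 , reverse rs) ∷ rest) × (∀ J → J ∈ rest → length (proj₂ J) < length rs)
  coarsenings-head []       = [] , refl , (λ J ())
  coarsenings-head (m ∷ rs) with coarsenings-head rs
  ... | rest , eq , shorter = map (snocPart m) rest ++ map (growLastPart m) (coarsenings i0 rs) ,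
        trans (cong (λ z → map (snocPart m) z ++ map (growLastPart m) (coarsenings i0 rs)) eq)
              (cong (λ z → (i0 , z) ∷ (map (snocPart m) rest ++ map (growLastPart m) (coarsenings i0 rs))) (sym (LP.unfold-reverse m rs))) ,
        shorter'
    where
    shorter' : ∀ J → J ∈ map (snocPart m) rest ++ map (growLastPart m) (coarsenings i0 rs) → length (proj₂ J) < suc (length rs)
    shorter' J J∈ with ∈-++⁻ (map (snocPart m) rest) J∈
    ... | inj₁ p with ∈-map⁻ (snocPart m) p
    ...   | (j0 , J') , J₀∈ , refl = subst (_< suc (length rs)) (sym (trans (LP.length-++ J') (ℕP.+-comm (length J') 1)))
              (s≤s (shorter (j0 , J') J₀∈))
    shorter' J J∈ | inj₂ p with ∈-map⁻ (growLastPart m) p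
    ...   | J₀ , J₀∈ , refl = s≤s (subst (_≤ length rs) (sym (length-growLastPart m J₀)) (coarsenings-length rs J₀ J₀∈))

-- The expansion of S̃^I

formulaB-snocPart : ∀ N m j0 J' → formulaB N (snocPart m (j0 , J')) ≡ signedΛSum N (length J' ℕ.+ 1) (BDes (j0 , J') ++ (j0 ℕ.+ sumℕ J') ∷ [])
formulaB-snocPart N m j0 J' = cong₂ (signedΛSum N) (LP.length-++ J') (BDes-snocPart m j0 J')

formulaB-growLastPart : ∀ N m J → formulaB N (growLastPart m J) ≡ signedΛSum N (length (proj₂ J)) (BDes J)
formulaB-growLastPart N m J = cong₂ (signedΛSum N) (length-growLastPart m J) (BDes-growLastPart m J)

formulaB-*S-θS : ∀ n m' J → IsBComp n J →
  formulaB n J *S θS (suc m') ≋ formulaB (n ℕ.+ suc m') (snocPart (suc m') J) ++ formulaB (n ℕ.+ suc m') (growLastPart (suc m') J)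
formulaB-*S-θS n m' J@(j0 , J') valid = begin
  signedΛSum n (length J') (BDes J) *S θS (suc m')  ≈⟨ *S-congˡ (signedΛSum n (length J') (BDes J)) (θS≋θΛ m') ⟩
  signedΛSum n (length J') (BDes J) *S θΛ (suc m')  ≈⟨ signedΛSum-*S-θΛ n m' (length J') (BDes J) (BDes-< n J valid) ⟩
  signedΛSum N (length J' ℕ.+ 1) (BDes J ++ n ∷ []) ++ signedΛSum N (length J') (BDes J)
    ≡⟨ sym (cong₂ _++_ (trans (formulaB-snocPart N (suc m') j0 J') (cong (λ z → signedΛSum N (length J' ℕ.+ 1) (BDes J ++ z ∷ [])) (proj₂ valid)))
                       (formulaB-growLastPart N (suc m') J)) ⟩
  formulaB N (snocPart (suc m') J) ++ formulaB N (growLastPart (suc m') J) ∎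
  where
  open ≋-Reasoning
  N = n ℕ.+ suc m'

prodS-++ : ∀ xs ys → prodS (xs ++ ys) ≡ prodS xs *S prodS ys
prodS-++ []       ys = sym (*S-identityˡ (prodS ys))
prodS-++ (x ∷ xs) ys = trans (cong (x *S_) (prodS-++ xs ys)) (sym (*S-assoc x (prodS xs) (prodS ys)))

S̃-snoc : ∀ i0 xs m → S̃ (i0 , xs ++ m ∷ []) ≡ S̃ (i0 , xs) *S θS m
S̃-snoc i0 xs m = begin
  S i0 *S prodS (map θS (xs ++ m ∷ []))          ≡⟨ cong (λ z → S i0 *S prodS z) (LP.map-++ θS xs (m ∷ [])) ⟩
  S i0 *S prodS (map θS xs ++ θS m ∷ [])         ≡⟨ cong (S i0 *S_) (prodS-++ (map θS xs) (θS m ∷ [])) ⟩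
  S i0 *S (prodS (map θS xs) *S (θS m *S oneS))  ≡⟨ cong (λ z → S i0 *S (prodS (map θS xs) *S z)) (*S-identityʳ (θS m)) ⟩
  S i0 *S (prodS (map θS xs) *S θS m)            ≡⟨ sym (*S-assoc (S i0) (prodS (map θS xs)) (θS m)) ⟩
  (S i0 *S prodS (map θS xs)) *S θS m            ∎
  where open ≡-Reasoning

S̃≋sumOver-coarsenings : ∀ i0 rs n → IsBComp n (i0 , reverse rs) → S̃ (i0 , reverse rs) ≋ sumOver (coarsenings i0 rs) (formulaB n)
S̃≋sumOver-coarsenings i0 [] n (_ , sum≡) = ≋-trans (≡⇒≋ (*S-identityʳ (S i0))) (≋-trans (≋-sym (formulaB-trivial i0))
  (≡⇒≋ (trans (cong (λ z → formulaB z (i0 , [])) (trans (sym (ℕP.+-identityʳ i0)) sum≡)) (sym (LP.++-identityʳ _)))))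
S̃≋sumOver-coarsenings i0 (m ∷ rs) n valid rewrite LP.unfold-reverse m rs with IsBComp-unsnoc n i0 (reverse rs) m valid
... | valid₀ , s≤s {n = m'} z≤n , refl = begin
  S̃ (i0 , reverse rs ++ suc m' ∷ [])                   ≡⟨ S̃-snoc i0 (reverse rs) (suc m') ⟩
  S̃ (i0 , reverse rs) *S θS (suc m')                   ≈⟨ *S-cong (S̃≋sumOver-coarsenings i0 rs n₀ valid₀) (≋-refl {θS (suc m')}) ⟩
  sumOver Js (formulaB n₀) *S θS (suc m')               ≡⟨ sumOver-*ʳ Js (formulaB n₀) (θS (suc m')) ⟩
  sumOver Js (λ J → formulaB n₀ J *S θS (suc m'))
    ≈⟨ sumOver-cong∈ Js (λ J J∈ → formulaB-*S-θS n₀ m' J (coarsenings-IsBComp i0 rs n₀ valid₀ J J∈)) ⟩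
  sumOver Js (λ J → formulaB N (snocPart (suc m') J) ++ formulaB N (growLastPart (suc m') J))
    ≈⟨ sumOver-+ Js _ _ ⟩
  sumOver Js (formulaB N ∘ snocPart (suc m')) ++ sumOver Js (formulaB N ∘ growLastPart (suc m'))
    ≡⟨ sym (trans (sumOver-++ (map (snocPart (suc m')) Js) _ (formulaB N))
         (cong₂ _++_ (sumOver-map Js (snocPart (suc m')) (formulaB N)) (sumOver-map Js (growLastPart (suc m')) (formulaB N)))) ⟩
  sumOver (coarsenings i0 (suc m' ∷ rs)) (formulaB N) ∎
  where
  open ≋-Reasoning
  Js = coarsenings i0 rs
  n₀ = i0 ℕ.+ sumℕ (reverse rs)
  N  = n₀ ℕ.+ suc m'

coarseningsOf : BComp → List BComp
coarseningsOf (i0 , I') = coarsenings i0 (reverse I')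

module _ {n i0 I'} (valid : IsBComp n (i0 , I')) where
  private
    I'≡ : reverse (reverse I') ≡ I'
    I'≡ = LP.reverse-involutive I'
    valid' : IsBComp n (i0 , reverse (reverse I'))
    valid' = subst (λ z → IsBComp n (i0 , z)) (sym I'≡) valid

  coarseningsOf-IsBComp : ∀ J → J ∈ coarseningsOf (i0 , I') → IsBComp n J
  coarseningsOf-IsBComp = coarsenings-IsBComp i0 (reverse I') n valid'

  coarseningsOf-head : Σ (List BComp) λ rest →
    (coarseningsOf (i0 , I') ≡ (i0 , I') ∷ rest) × (∀ J → J ∈ rest → length (proj₂ J) < length I')
  coarseningsOf-head with coarsenings-head i0 (reverse I')
  ... | rest , eq , shorter = rest , trans eq (cong (λ z → (i0 , z) ∷ rest) I'≡) ,
        (λ J J∈ → subst (length (proj₂ J) <_) (LP.length-reverse I') (shorter J J∈))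

  S̃≋sumOver-coarseningsOf : S̃ (i0 , I') ≋ sumOver (coarseningsOf (i0 , I')) (formulaB n)
  S̃≋sumOver-coarseningsOf = subst (λ z → S̃ (i0 , z) ≋ sumOver (coarseningsOf (i0 , I')) (formulaB n)) I'≡
    (S̃≋sumOver-coarsenings i0 (reverse I') n valid')

  filter-BDes-⊆↭coarseningsOf : filterᵇ (λ J → BDes J ⊆ᵇ BDes (i0 , I')) (bcomps n) ↭ coarseningsOf (i0 , I')
  filter-BDes-⊆↭coarseningsOf = ∼bag⇒↭ (unique∧set⇒bag
    (UP.filter⁺ (T? ∘ below) (bcomps-unique n)) (coarsenings-unique i0 (reverse I') n valid') (mk⇔ to from))
    where
    below : BComp → Bool
    below J = BDes J ⊆ᵇ BDes (i0 , I')
    to : ∀ {J} → J ∈ filterᵇ below (bcomps n) → J ∈ coarseningsOf (i0 , I')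
    to {J} J∈ with ∈-filter⁻ (T? ∘ below) {xs = bcomps n} J∈
    ... | J∈bcomps , J-below = coarsenings-complete i0 (reverse I') n valid' J (bcomps-sound n J J∈bcomps)
      (subst (λ z → BDes J ⊆ᵐ BDes (i0 , z)) (sym I'≡) (⊆ᵇ⇒⊆ᵐ (BDes J) (BDes (i0 , I')) J-below))
    from : ∀ {J} → J ∈ coarseningsOf (i0 , I') → J ∈ filterᵇ below (bcomps n)
    from {J} J∈ = ∈-filter⁺ (T? ∘ below) (bcomps-complete n J (coarseningsOf-IsBComp J J∈))
      (⊆ᵐ⇒⊆ᵇ (BDes J) (BDes (i0 , I')) (subst (λ z → BDes J ⊆ᵐ BDes (i0 , z)) I'≡ (coarsenings-⊆ i0 (reverse I') n valid' J J∈)))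

-- I is the only coarsening of I with as many parts, so the system "Σ over coarsenings" is triangular.
coarseningsOf-triangular : ∀ n (f g : BComp → SymT) →
  (∀ I → IsBComp n I → sumOver (coarseningsOf I) f ≋ sumOver (coarseningsOf I) g) →
  ∀ I → IsBComp n I → f I ≋ g I
coarseningsOf-triangular n f g sums≋ (i0 , I') valid = below (suc (length I')) i0 I' valid ℕP.≤-refl
  where
  below : ∀ k i0 I' → IsBComp n (i0 , I') → length I' < k → f (i0 , I') ≋ g (i0 , I')
  below (suc k) i0 I' valid ℓ<k with coarseningsOf-head valid
  ... | rest , eq , shorter = ++-cancelʳ-≋ (begin
    f (i0 , I') ++ sumOver rest g ≈⟨ ++-congˡ (f (i0 , I')) (≋-sym rest≋) ⟩
    f (i0 , I') ++ sumOver rest f ≡⟨ cong (λ Js → sumOver Js f) (sym eq) ⟩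
    sumOver (coarseningsOf (i0 , I')) f ≈⟨ sums≋ (i0 , I') valid ⟩
    sumOver (coarseningsOf (i0 , I')) g ≡⟨ cong (λ Js → sumOver Js g) eq ⟩
    g (i0 , I') ++ sumOver rest g ∎)
    where
    open ≋-Reasoning
    rest≋ : sumOver rest f ≋ sumOver rest g
    rest≋ = sumOver-cong∈ rest (λ (j0 , J') J∈ → below k j0 J'
      (coarseningsOf-IsBComp valid (j0 , J') (subst ((j0 , J') ∈_) (sym eq) (there J∈)))
      (ℕP.<-≤-trans (shorter (j0 , J') J∈) (ℕP.≤-pred ℓ<k)))

proposition6p8 : (n : ℕ) → 1 ≤ n → (R̃ : BComp → SymT)
    → (∀ I → IsBComp n I → S̃ I ≈ sumS (map R̃ (filterᵇ (λ J → BDes J ⊆ᵇ BDes I) (bcomps n))))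
    → ∀ I → IsBComp n I → R̃ I ≈ formula n I
proposition6p8 n _ R̃ S̃≈sumR̃ = λ I valid → get (coarseningsOf-triangular n R̃ (formula n) sums≋ I valid)
  where
  sums≋ : ∀ I → IsBComp n I → sumOver (coarseningsOf I) R̃ ≋ sumOver (coarseningsOf I) (formula n)
  sums≋ I@(i0 , I') valid = begin
    sumOver (coarseningsOf I) R̃                                        ≈⟨ sumOver-↭ R̃ (↭.↭-sym (filter-BDes-⊆↭coarseningsOf valid)) ⟩
    sumOver (filterᵇ (λ J → BDes J ⊆ᵇ BDes I) (bcomps n)) R̃            ≡⟨ sym (sumS-map≡sumOver (filterᵇ (λ J → BDes J ⊆ᵇ BDes I) (bcomps n)) R̃) ⟩
    sumS (map R̃ (filterᵇ (λ J → BDes J ⊆ᵇ BDes I) (bcomps n)))         ≈⟨ ≋-sym (mk≋ (S̃≈sumR̃ I valid)) ⟩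
    S̃ I                                                                ≈⟨ S̃≋sumOver-coarseningsOf valid ⟩
    sumOver (coarseningsOf I) (formulaB n)
      ≈⟨ sumOver-cong∈ (coarseningsOf I) (λ J J∈ → ≋-sym (formula≋formulaB n J (coarseningsOf-IsBComp valid J J∈))) ⟩
    sumOver (coarseningsOf I) (formula n)                              ∎
    where open ≋-Reasoning
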